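{- Let $p$ be a positive integer and suppose $G$ is a simple graph of order $p+3$ not containing $B_p$ as a subgraph. (1) If $p=2$, then $G$ has size $\mathrm{ex}(p+3,B_p)$ if and only if $G=K_1\vee (2P_2)$, or $G=K_{2,3}$, or $G=\overline{P_5}$; if $p$ is even and $p\ge 4$, then $G$ has size $\mathrm{ex}(p+3,B_p)$ if and only if $G=(3K_1)\vee (K_p-PM)$ or $G=\overline{P_5}\vee (K_{p-2}-PM)$. (2) If $p$ is odd, then $G$ has size $\mathrm{ex}(p+3,B_p)$ if and only if $G=K_{p+3}-PM$.
   Context: Graphs are finite and simple; equality of graphs means isomorphism. The book $B_p$ is the graph consisting of $p$ triangles sharing a common edge. For a graph $H$ and positive integer $n$, $\mathrm{ex}(n,H)$ is the maximum number of edges of a simple graph of order $n$ not containing $H$ as a subgraph. $mH$ denotes the disjoint union of $m$ copies of $H$, $G\vee H$ the join (disjoint union plus all edges between $G$ and $H$), $\overline{G}$ the complement. $K_n$ is the complete graph, $K_{s,t}$ the complete bipartite graph, $P_t$ the path on $t$ vertices. For even $n$, $K_n-PM$ is the graph obtained from $K_n$ by deleting the edges of a perfect matching, i.e. the complement of $(n/2)K_2$. -}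

module Defs where

open import Data.Nat using (ℕ; zero; suc; _+_; _*_; _≤_)
open import Data.Nat.Base using (_<ᵇ_; _≡ᵇ_)
open import Data.Bool using (Bool; true; false; _∧_; _∨_; not; if_then_else_)
open import Data.Fin using (Fin; toℕ; splitAt; _≟_)
open import Data.Sum using (_⊎_; inj₁; inj₂)
open import Data.Product using (Σ; _×_; _,_)
open import Data.List using (List; map; allFin)
open import Data.Nat.ListAction using (sum)
open import Relation.Nullary using (¬_)
open import Relation.Nullary.Decidable using (⌊_⌋)
open import Relation.Binary.PropositionalEquality using (_≡_)
open import Function.Bundles using (_↔_; Inverse)
open import Function.Definitions using (Injective)

-- A simple graph on vertex set Fin n.  Any Boolean relation is allowed;
-- it is read as a simple graph by symmetrising and dropping loops (see adj).
record Graph (n : ℕ) : Set where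
  constructor graph
  field
    rel : Fin n → Fin n → Bool
open Graph public

adj : ∀ {n} → Graph n → Fin n → Fin n → Bool
adj G i j = not ⌊ i ≟ j ⌋ ∧ (rel G i j ∨ rel G j i)

Adj : ∀ {n} → Graph n → Fin n → Fin n → Set
Adj G i j = adj G i j ≡ true

bit : Bool → ℕ
bit true = 1
bit false = 0

size : ∀ {n} → Graph n → ℕ
size {n} G = sum (map (λ i → sum (map (λ j → bit ((toℕ i <ᵇ toℕ j) ∧ adj G i j)) (allFin n))) (allFin n))

-- graph isomorphism (equality of graphs), possibly between different index expressions for the order
_≅_ : ∀ {n m} → Graph n → Graph m → Set
_≅_ {n} {m} G H = Σ (Fin n ↔ Fin m) λ f → ∀ i j → adj G i j ≡ adj H (Inverse.to f i) (Inverse.to f j)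

_⊆_ : ∀ {k n} → Graph k → Graph n → Set
_⊆_ {k} {n} H G = Σ (Fin k → Fin n) λ f → Injective _≡_ _≡_ f × (∀ i j → Adj H i j → Adj G (f i) (f j))

IsEx : ∀ {k} → ℕ → Graph k → ℕ → Set
IsEx n H m = Σ (Graph n) (λ G → ¬ (H ⊆ G) × size G ≡ m) × (∀ (G : Graph n) → ¬ (H ⊆ G) → size G ≤ m)

emptyG : ∀ n → Graph n
emptyG n = graph (λ _ _ → false)

K : ∀ n → Graph n
K n = graph (λ _ _ → true)

P : ∀ t → Graph t
P t = graph (λ i j → toℕ j ≡ᵇ suc (toℕ i))

compl : ∀ {n} → Graph n → Graph n
compl G = graph (λ i j → not (adj G i j))

_⊕_ : ∀ {m n} → Graph m → Graph n → Graph (m + n)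
_⊕_ {m} G H = graph λ i j → f (splitAt m i) (splitAt m j)
  where
  f : _ → _ → Bool
  f (inj₁ a) (inj₁ b) = rel G a b
  f (inj₂ a) (inj₂ b) = rel H a b
  f _ _ = false

_∨G_ : ∀ {m n} → Graph m → Graph n → Graph (m + n)
_∨G_ {m} G H = graph λ i j → f (splitAt m i) (splitAt m j)
  where
  f : _ → _ → Bool
  f (inj₁ a) (inj₁ b) = rel G a b
  f (inj₂ a) (inj₂ b) = rel H a b
  f _ _ = true

copies : ∀ {k} m → Graph k → Graph (m * k)
copies zero H = emptyG 0
copies (suc m) H = H ⊕ copies m H

KminusPM : ∀ k → Graph (k * 2)
KminusPM k = compl (copies k (K 2))

Book : ∀ p → Graph (2 + p)
Book p = K 2 ∨G emptyG p

Kbip : ∀ s t → Graph (s + t)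
Kbip s t = emptyG s ∨G emptyG t

-- Let H be the complement of G, of order n = p + 3. An edge uv of G spans a B_p exactly when all but at most one of
-- the other p + 1 vertices are adjacent in H to neither u nor v. So G is B_p-free iff every pair u, v non-adjacent
-- in H has two further vertices adjacent in H to u or v, and maximising the size of G means minimising that of H
-- under this condition. If H has an isolated vertex, all other degrees are at least 2; otherwise two leaves of H
-- never share a neighbour. Hence the degree sum of H is at least n, with equality only for a perfect matching, and
-- for odd n, where the degree sum is even and n + 1 is impossible, it is at least n + 3, with equality only for a
-- triangle or a P₅ plus a perfect matching, or (n = 5) a 4-cycle plus an isolated vertex. Complementing these gives
-- the extremal graphs.

module Submission where

open import Defs
open import Data.Nat using (ℕ; zero; suc; _+_; _*_; _∸_; _≤_; _<_; z≤n; s≤s; s≤s⁻¹; _<ᵇ_)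
open import Data.Nat.Properties renaming (_≟_ to _≟ℕ_)
open import Data.Bool using (Bool; true; false; _∧_; _∨_; not; T)
open import Data.Bool.Properties using (∧-zeroʳ; ∨-comm; ∨-zeroʳ; ∨-conicalˡ; ∨-conicalʳ; not-involutive; not-injective) renaming (_≟_ to _≟ᵇ_)
open import Data.Fin using (Fin; zero; suc; toℕ; splitAt; punchIn; punchOut; _↑ˡ_; _↑ʳ_; join)
open import Data.Fin.Properties
  using (_≟_; punchIn-injective; punchInᵢ≢i; punchOut-injective; punchIn-punchOut; toℕ-injective; injective⇒≤;
         splitAt-↑ˡ; splitAt-↑ʳ; join-splitAt; ↑ˡ-injective; ↑ʳ-injective; splitAt⁻¹-↑ˡ; splitAt⁻¹-↑ʳ; any?; all?)
  renaming (suc-injective to Fin-suc-injective; 0≢1+n to Fin-0≢1+n)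
open import Data.Sum using (_⊎_; inj₁; inj₂)
open import Data.Product using (Σ; _×_; _,_; proj₁; proj₂; ∃-syntax)
open import Data.Empty using (⊥; ⊥-elim)
open import Data.Unit using (tt)
open import Relation.Nullary using (¬_; Dec; yes; no)
open import Relation.Nullary.Decidable using (⌊_⌋; ¬?; _×-dec_; _→-dec_; toWitness)
open import Relation.Binary using (tri<; tri≈; tri>)
open import Relation.Binary.PropositionalEquality using (_≡_; _≢_; ≢-sym; refl; sym; trans; cong; cong₂; subst; module ≡-Reasoning)
open import Function.Bundles using (_⇔_; _↔_; Inverse; Equivalence; mk↔ₛ′; mk⇔)
open import Function.Definitions using (Injective)
open import Function.Base using (case_of_)
open import Data.List using (map; allFin; tabulate)
import Data.Nat.ListAction as List
open import Data.Nat.Tactic.RingSolver using (solve-∀)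
open import Algebra.Properties.CommutativeMonoid.Sum +-0-commutativeMonoid
  using (sum; sum-cong-≗; ∑-distrib-+; ∑-comm; sum-remove; sum-permute)

true≢false : true ≡ false → ⊥
true≢false ()

sum-const : ∀ {n} c → sum {n} (λ _ → c) ≡ n * c
sum-const {zero} c = refl
sum-const {suc n} c = cong (c +_) (sum-const {n} c)

sum-mono-≤ : ∀ {n} {f g : Fin n → ℕ} → (∀ i → f i ≤ g i) → sum f ≤ sum g
sum-mono-≤ {zero} h = z≤n
sum-mono-≤ {suc n} h = +-mono-≤ (h zero) (sum-mono-≤ (λ i → h (suc i)))

term≤sum : ∀ {n} (v : Fin n) (f : Fin n → ℕ) → f v ≤ sum f
term≤sum {suc n} v f = subst (f v ≤_) (sym (sum-remove {i = v} f)) (m≤m+n (f v) _)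

sum-++ : ∀ t r (g : Fin (t + r) → ℕ) → sum g ≡ sum (λ c → g (c ↑ˡ r)) + sum (λ y → g (t ↑ʳ y))
sum-++ zero r g = refl
sum-++ (suc t) r g = trans (cong (g zero +_) (sum-++ t r (λ i → g (suc i)))) (sym (+-assoc (g zero) _ _))

punchIn-cover : ∀ {n} {p q : Fin (suc n)} → p ≢ q → ∃[ q' ] q ≡ punchIn p q'
punchIn-cover {p = p} {q} p≢q = punchOut p≢q , sym (punchIn-punchOut p≢q)

length≤sum : ∀ {m} (h : Fin m → ℕ) → (∀ x → 1 ≤ h x) → m ≤ sum h
length≤sum {m} h p = ≤-trans (≤-reflexive (sym (trans (sum-const {m} 1) (*-identityʳ m)))) (sum-mono-≤ p)

sum≤length : ∀ {m} (h : Fin m → ℕ) → (∀ x → h x ≤ 1) → sum h ≤ m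
sum≤length {m} h p = ≤-trans (sum-mono-≤ p) (≤-reflexive (trans (sum-const {m} 1) (*-identityʳ m)))

double-length≤sum : ∀ {m} (h : Fin m → ℕ) → (∀ x → 2 ≤ h x) → m + m ≤ sum h
double-length≤sum {m} h p =
  ≤-trans (≤-reflexive (sym (trans (sum-const {m} 2) (trans (*-comm m 2) (cong (m +_) (+-identityʳ m)))))) (sum-mono-≤ p)

length<sum⇒≥2 : ∀ {m} (h : Fin m → ℕ) → m < sum h → ∃[ x ] 2 ≤ h x
length<sum⇒≥2 {m} h m<∑h with any? (λ x → 2 ≤? h x)
... | yes w = w
... | no nw = ⊥-elim (<-irrefl refl (≤-trans m<∑h (sum≤length h ≤1)))
  where
  ≤1 : ∀ x → h x ≤ 1
  ≤1 x with 2 ≤? h x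
  ... | yes q = ⊥-elim (nw (x , q))
  ... | no q = s≤s⁻¹ (≰⇒> q)

sum≥₁ : ∀ {m} (g : Fin (suc m) → ℕ) → (∀ i → 1 ≤ g i) → ∀ p → g p + m ≤ sum g
sum≥₁ g h p =
  ≤-trans (+-monoʳ-≤ (g p) (length≤sum (λ x → g (punchIn p x)) (λ x → h (punchIn p x)))) (≤-reflexive (sym (sum-remove g)))

sum≥₂ : ∀ {m} (g : Fin (suc (suc m)) → ℕ) → (∀ i → 1 ≤ g i) → ∀ p q → p ≢ q → g p + (g q + m) ≤ sum g
sum≥₂ g h p q p≢q with punchIn-cover p≢q
... | q' , refl =
  ≤-trans (+-monoʳ-≤ (g p) (sum≥₁ (λ x → g (punchIn p x)) (λ x → h (punchIn p x)) q')) (≤-reflexive (sym (sum-remove g)))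

sum≥₃ : ∀ {m} (g : Fin (suc (suc (suc m))) → ℕ) → (∀ i → 1 ≤ g i) → ∀ p q r → p ≢ q → p ≢ r → q ≢ r →
        g p + (g q + (g r + m)) ≤ sum g
sum≥₃ g h p q r p≢q p≢r q≢r with punchIn-cover p≢q | punchIn-cover p≢r
... | q' , refl | r' , refl =
  ≤-trans (+-monoʳ-≤ (g p) (sum≥₂ (λ x → g (punchIn p x)) (λ x → h (punchIn p x)) q' r' (λ e → q≢r (cong (punchIn p) e))))
          (≤-reflexive (sym (sum-remove g)))

sum≥₄ : ∀ {m} (g : Fin (suc (suc (suc (suc m)))) → ℕ) → (∀ i → 1 ≤ g i) → ∀ p q r s →
        p ≢ q → p ≢ r → p ≢ s → q ≢ r → q ≢ s → r ≢ s → g p + (g q + (g r + (g s + m))) ≤ sum g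
sum≥₄ g h p q r s p≢q p≢r p≢s q≢r q≢s r≢s with punchIn-cover p≢q | punchIn-cover p≢r | punchIn-cover p≢s
... | q' , refl | r' , refl | s' , refl =
  ≤-trans (+-monoʳ-≤ (g p) (sum≥₃ (λ x → g (punchIn p x)) (λ x → h (punchIn p x)) q' r' s'
            (λ e → q≢r (cong (punchIn p) e)) (λ e → q≢s (cong (punchIn p) e)) (λ e → r≢s (cong (punchIn p) e))))
          (≤-reflexive (sym (sum-remove g)))

sum>₁⇒≥2 : ∀ {m} (g : Fin (suc m) → ℕ) p → g p + m < sum g → ∃[ r ] r ≢ p × 2 ≤ g r
sum>₁⇒≥2 g p h with length<sum⇒≥2 (λ x → g (punchIn p x)) (+-cancelˡ-< (g p) _ _ (≤-trans h (≤-reflexive (sum-remove g))))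
... | x , q = punchIn p x , punchInᵢ≢i p x , q

sum>₂⇒≥2 : ∀ {m} (g : Fin (suc (suc m)) → ℕ) p q → p ≢ q → g p + (g q + m) < sum g → ∃[ r ] r ≢ p × r ≢ q × 2 ≤ g r
sum>₂⇒≥2 g p q p≢q h with punchIn-cover p≢q
... | q' , refl with sum>₁⇒≥2 (λ x → g (punchIn p x)) q' (+-cancelˡ-< (g p) _ _ (≤-trans h (≤-reflexive (sum-remove g))))
...   | x , x≢q , r = punchIn p x , punchInᵢ≢i p x , (λ e → x≢q (punchIn-injective p x q' e)) , r

count : ∀ {n} → (Fin n → Bool) → ℕ
count f = sum (λ x → bit (f x))

count≥1 : ∀ {n} (f : Fin n → Bool) {x} → f x ≡ true → 1 ≤ count f
count≥1 f {x} fx = ≤-trans (subst (λ b → 1 ≤ bit b) (sym fx) (s≤s z≤n)) (term≤sum x (λ y → bit (f y)))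

count≥2 : ∀ {n} (f : Fin n → Bool) {x y} → x ≢ y → f x ≡ true → f y ≡ true → 2 ≤ count f
count≥2 {suc n} f {x} x≢y fx fy with punchIn-cover x≢y
... | y' , refl = subst (2 ≤_) (sym (sum-remove {i = x} (λ z → bit (f z))))
  (subst (λ b → 2 ≤ bit b + count (λ z → f (punchIn x z))) (sym fx) (s≤s (count≥1 (λ z → f (punchIn x z)) fy)))

count≥3 : ∀ {n} (f : Fin n → Bool) {x y z} → x ≢ y → x ≢ z → y ≢ z →
          f x ≡ true → f y ≡ true → f z ≡ true → 3 ≤ count f
count≥3 {suc n} f {x} x≢y x≢z y≢z fx fy fz with punchIn-cover x≢y | punchIn-cover x≢z
... | y' , refl | z' , refl = subst (3 ≤_) (sym (sum-remove {i = x} (λ w → bit (f w))))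
  (subst (λ b → 3 ≤ bit b + count (λ w → f (punchIn x w))) (sym fx)
    (s≤s (count≥2 (λ w → f (punchIn x w)) (λ e → y≢z (cong (punchIn x) e)) fy fz)))

count≡0 : ∀ {n} (f : Fin n → Bool) → (∀ x → f x ≡ false) → count f ≡ 0
count≡0 {n} f h = trans (sum-cong-≗ (λ x → cong bit (h x))) (trans (sum-const {n} 0) (*-zeroʳ n))

count-witness : ∀ {n} (f : Fin n → Bool) → 1 ≤ count f → ∃[ x ] f x ≡ true
count-witness f h with any? (λ x → f x ≟ᵇ true)
... | yes w = w
... | no nw = ⊥-elim (1+n≰n (≤-trans h (≤-reflexive (count≡0 f (λ x → false-if (f x) refl)))))
  where
  false-if : ∀ {x} b → f x ≡ b → f x ≡ false
  false-if {x} true e = ⊥-elim (nw (x , e))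
  false-if false e = e

count-after : ∀ {n} (f : Fin (suc n) → Bool) {x} → f x ≡ true → ∀ {k} → suc k ≤ count f →
              k ≤ count (λ z → f (punchIn x z))
count-after f {x} fx {k} h = s≤s⁻¹ (subst (λ b → suc k ≤ bit b + count (λ z → f (punchIn x z))) fx
                                      (subst (suc k ≤_) (sum-remove {i = x} (λ z → bit (f z))) h))

count-witnesses₂ : ∀ {n} (f : Fin n → Bool) → 2 ≤ count f → ∃[ x ] ∃[ y ] x ≢ y × f x ≡ true × f y ≡ true
count-witnesses₂ {zero} f ()
count-witnesses₂ {suc n} f h with count-witness f (≤-trans (s≤s z≤n) h)
... | x , fx with count-witness (λ z → f (punchIn x z)) (count-after f fx h)
...   | y' , fy = x , punchIn x y' , (λ e → punchInᵢ≢i x y' (sym e)) , fx , fy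

count-witnesses₃ : ∀ {n} (f : Fin n → Bool) → 3 ≤ count f →
                   ∃[ x ] ∃[ y ] ∃[ z ] x ≢ y × x ≢ z × y ≢ z × f x ≡ true × f y ≡ true × f z ≡ true
count-witnesses₃ {zero} f ()
count-witnesses₃ {suc n} f h with count-witness f (≤-trans (s≤s z≤n) h)
... | x , fx with count-witnesses₂ (λ w → f (punchIn x w)) (count-after f fx h)
...   | y' , z' , y'≢z' , fy , fz =
  x , punchIn x y' , punchIn x z' , (λ e → punchInᵢ≢i x y' (sym e)) , (λ e → punchInᵢ≢i x z' (sym e)) ,
  (λ e → y'≢z' (punchIn-injective x y' z' e)) , fx , fy , fz

count≤1-unique : ∀ {n} (f : Fin n → Bool) → count f ≤ 1 → ∀ {x y} → f x ≡ true → f y ≡ true → x ≡ y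
count≤1-unique f h {x} {y} fx fy with x ≟ y
... | yes e = e
... | no x≢y = ⊥-elim (1+n≰n (≤-trans (count≥2 f x≢y fx fy) h))

Inj : ∀ {m n} → (Fin m → Fin n) → Set
Inj f = Injective _≡_ _≡_ f

injective⇒surjective : ∀ {m n} (f : Fin m → Fin n) → Inj f → m ≡ n → ∀ v → ∃[ i ] f i ≡ v
injective⇒surjective {m} {suc n} f f-inj refl v with any? (λ i → f i ≟ v)
... | yes w = w
... | no nw = ⊥-elim (1+n≰n (injective⇒≤ {f = g} g-inj))
  where
  g : Fin m → Fin n
  g i = punchOut {i = v} {j = f i} (λ q → nw (i , sym q))
  g-inj : Inj g
  g-inj {i} {j} q = f-inj (punchOut-injective (λ q' → nw (i , sym q')) (λ q' → nw (j , sym q')) q)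

injective⇒↔ : ∀ {m n} (f : Fin m → Fin n) → Inj f → m ≡ n → Fin m ↔ Fin n
injective⇒↔ f f-inj m≡n =
  mk↔ₛ′ f (λ v → proj₁ (onto v)) (λ v → proj₂ (onto v)) (λ i → f-inj (proj₂ (onto (f i))))
  where onto = injective⇒surjective f f-inj m≡n

fresh : ∀ {m n} (f : Fin m → Fin n) → Inj f → m < n → ∃[ v ] ∀ i → f i ≢ v
fresh {m} {n} f f-inj m<n with any? (λ v → all? (λ i → ¬? (f i ≟ v)))
... | yes w = w
... | no nw = ⊥-elim (<-irrefl refl (≤-trans m<n (injective⇒≤ {f = g} g-inj)))
  where
  preimage : ∀ v → ∃[ i ] f i ≡ v
  preimage v with any? (λ i → f i ≟ v)
  ... | yes w = w
  ... | no nw' = ⊥-elim (nw (v , λ i e → nw' (i , e)))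
  g : Fin n → Fin m
  g v = proj₁ (preimage v)
  g-inj : Inj g
  g-inj {v} {w} e = trans (sym (proj₂ (preimage v))) (trans (cong f e) (proj₂ (preimage w)))

avoid-two : ∀ {n m} (f : Fin m → Fin (suc (suc n))) → Inj f →
            ∀ {w₁ w₂} → w₁ ≢ w₂ → (∀ i → f i ≢ w₁) → (∀ i → f i ≢ w₂) → m ≤ n
avoid-two {n} {m} f f-inj {w₁} {w₂} w₁≢w₂ miss₁ miss₂ = injective⇒≤ {f = h′} h′-inj
  where
  h : Fin m → Fin (suc n)
  h i = punchOut {i = w₁} {j = f i} (λ e → miss₁ i (sym e))
  w₂≢h : ∀ i → punchOut w₁≢w₂ ≢ h i
  w₂≢h i e = miss₂ i (sym (punchOut-injective w₁≢w₂ (λ e → miss₁ i (sym e)) e))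
  h′ : Fin m → Fin n
  h′ i = punchOut (w₂≢h i)
  h′-inj : Inj h′
  h′-inj {i} {j} e = f-inj (punchOut-injective {i = w₁} (λ q → miss₁ i (sym q)) (λ q → miss₁ j (sym q))
                                                (punchOut-injective (w₂≢h i) (w₂≢h j) e))

sum-reindex : ∀ {m n} (f : Fin n → ℕ) (h : Fin m → Fin n) → Inj h → m ≡ n → sum f ≡ sum (λ i → f (h i))
sum-reindex f h h-inj m≡n = sum-permute f (injective⇒↔ h h-inj m≡n)

injective-by-< : ∀ {m n} (f : Fin m → Fin n) → (∀ i j → toℕ i < toℕ j → f i ≢ f j) → Inj f
injective-by-< f h {i} {j} e with <-cmp (toℕ i) (toℕ j)
... | tri< i<j _ _ = ⊥-elim (h i j i<j e)
... | tri≈ _ i≡j _ = toℕ-injective i≡j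
... | tri> _ _ j<i = ⊥-elim (h j i j<i (sym e))

Adjacency : ℕ → Set
Adjacency n = Fin n → Fin n → Bool

SymAdj : ∀ {n} → Adjacency n → Set
SymAdj a = ∀ i j → a i j ≡ a j i

Loopless : ∀ {n} → Adjacency n → Set
Loopless a = ∀ i → a i i ≡ false

degree : ∀ {n} → Adjacency n → Fin n → ℕ
degree a i = count (a i)

before : ∀ {n} → Fin n → Fin n → Bool
before i j = toℕ i <ᵇ toℕ j

edges : ∀ {n} → Adjacency n → ℕ
edges a = sum (λ i → count (λ j → before i j ∧ a i j))

before⇒≢ : ∀ {n} {i j : Fin n} → before i j ≡ true → i ≢ j
before⇒≢ {i = i} e refl = <-irrefl refl (<ᵇ⇒< (toℕ i) (toℕ i) (subst T (sym e) tt))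

edge-split : ∀ {n} (a : Adjacency n) → SymAdj a → Loopless a → ∀ i j →
             bit (a i j) ≡ bit (before i j ∧ a i j) + bit (before j i ∧ a j i)
edge-split a sym-a loopless i j with before i j in i<j | before j i in j<i
... | true | true = ⊥-elim (<-asym (<ᵇ⇒< (toℕ i) (toℕ j) (subst T (sym i<j) tt)) (<ᵇ⇒< (toℕ j) (toℕ i) (subst T (sym j<i) tt)))
... | true | false = sym (+-identityʳ _)
... | false | true = cong bit (sym-a i j)
... | false | false with <-cmp (toℕ i) (toℕ j)
...   | tri< p _ _ = ⊥-elim (subst T i<j (<⇒<ᵇ p))
...   | tri> _ _ p = ⊥-elim (subst T j<i (<⇒<ᵇ p))
...   | tri≈ _ p _ rewrite toℕ-injective {i = i} {j} p | loopless j = refl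

handshake : ∀ {n} (a : Adjacency n) → SymAdj a → Loopless a → sum (degree a) ≡ edges a + edges a
handshake a sym-a loopless = begin
    sum (λ i → sum (λ j → bit (a i j)))
  ≡⟨ sum-cong-≗ (λ i → sum-cong-≗ (λ j → edge-split a sym-a loopless i j)) ⟩
    sum (λ i → sum (λ j → bit (before i j ∧ a i j) + bit (before j i ∧ a j i)))
  ≡⟨ sum-cong-≗ (λ i → ∑-distrib-+ (λ j → bit (before i j ∧ a i j)) (λ j → bit (before j i ∧ a j i))) ⟩
    sum (λ i → count (λ j → before i j ∧ a i j) + count (λ j → before j i ∧ a j i))
  ≡⟨ ∑-distrib-+ (λ i → count (λ j → before i j ∧ a i j)) (λ i → count (λ j → before j i ∧ a j i)) ⟩
    edges a + sum (λ i → count (λ j → before j i ∧ a j i))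
  ≡⟨ cong (edges a +_) (∑-comm (λ j i → bit (before i j ∧ a i j))) ⟩
    edges a + edges a
  ∎
  where open ≡-Reasoning

HasUniqueNeighbour : ∀ {n} → Adjacency n → Fin n → Set
HasUniqueNeighbour {n} a v = ∃[ q ] a v q ≡ true × (∀ q' → a v q' ≡ true → q' ≡ q)

unique⇒degree≡1 : ∀ {n} (a : Adjacency n) {v} → HasUniqueNeighbour a v → degree a v ≡ 1
unique⇒degree≡1 {suc n} a {v} (q , vq , unique) = trans (sum-remove {i = q} (λ w → bit (a v w)))
  (trans (cong (λ b → bit b + count (λ x → a v (punchIn q x))) vq) (cong suc (count≡0 (λ x → a v (punchIn q x)) others)))
  where
  others : ∀ x → a v (punchIn q x) ≡ false
  others x with a v (punchIn q x) in e
  ... | false = refl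
  ... | true = ⊥-elim (punchInᵢ≢i q x (unique _ e))

degree≤1-unique : ∀ {n} (a : Adjacency n) {v} → degree a v ≤ 1 → ∀ {x y} → a v x ≡ true → a v y ≡ true → x ≡ y
degree≤1-unique a h = count≤1-unique (a _) h

degree≡1⇒unique : ∀ {n} (a : Adjacency n) {v} → 1 ≤ degree a v → degree a v ≤ 1 → HasUniqueNeighbour a v
degree≡1⇒unique a {v} h₁ h₂ with count-witness (a v) h₁
... | q , vq = q , vq , λ q' vq' → degree≤1-unique a h₂ vq' vq

degree≤2-cover : ∀ {n} (a : Adjacency n) {w} → degree a w ≤ 2 → ∀ {x y z} → x ≢ y → a w x ≡ true → a w y ≡ true →
                 a w z ≡ true → z ≡ x ⊎ z ≡ y
degree≤2-cover a {w} h {x} {y} {z} x≢y wx wy wz with z ≟ x | z ≟ y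
... | yes e | _ = inj₁ e
... | no _ | yes e = inj₂ e
... | no z≢x | no z≢y = ⊥-elim (1+n≰n (≤-trans (count≥3 (a w) x≢y (λ e → z≢x (sym e)) (λ e → z≢y (sym e)) wx wy wz) h))

non-neighbour₁ : ∀ {n} (a : Adjacency n) {p q r} → degree a p ≤ 1 → a p q ≡ true → r ≢ q → a p r ≡ false
non-neighbour₁ a {p} {q} {r} h pq r≢q with a p r in pr
... | false = refl
... | true = ⊥-elim (r≢q (degree≤1-unique a h pr pq))

non-neighbour₂ : ∀ {n} (a : Adjacency n) {p q₁ q₂ r} → degree a p ≤ 2 → a p q₁ ≡ true → a p q₂ ≡ true → q₁ ≢ q₂ →
                 r ≢ q₁ → r ≢ q₂ → a p r ≡ false
non-neighbour₂ a {p} {r = r} h pq₁ pq₂ q₁≢q₂ r≢q₁ r≢q₂ with a p r in pr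
... | false = refl
... | true with degree≤2-cover a h q₁≢q₂ pq₁ pq₂ pr
...   | inj₁ e = ⊥-elim (r≢q₁ e)
...   | inj₂ e = ⊥-elim (r≢q₂ e)

another-neighbour : ∀ {n} (a : Adjacency n) {x} → 2 ≤ degree a x → ∀ y → ∃[ l ] a x l ≡ true × l ≢ y
another-neighbour a {x} h y with count-witnesses₂ (a x) h
... | p , q , p≢q , xp , xq with p ≟ y
...   | yes refl = q , xq , λ e → p≢q (sym e)
...   | no p≢y = p , xp , p≢y

neighbour-≢ : ∀ {n} (a : Adjacency n) → Loopless a → ∀ {v w} → a v w ≡ true → v ≢ w
neighbour-≢ a loopless {v} e refl = true≢false (trans (sym e) (loopless v))

isolated-or-positive : ∀ {n} (a : Adjacency n) → (∃[ u ] degree a u ≡ 0) ⊎ (∀ v → 1 ≤ degree a v)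
isolated-or-positive a with any? (λ u → degree a u ≟ℕ 0)
... | yes w = inj₁ w
... | no nw = inj₂ (λ v → positive v (degree a v) refl)
  where
  positive : ∀ v k → degree a v ≡ k → 1 ≤ degree a v
  positive v zero e = ⊥-elim (nw (v , e))
  positive v (suc k) e = subst (1 ≤_) (sym e) (s≤s z≤n)

≟-refl : ∀ {n} (i : Fin n) → ⌊ i ≟ i ⌋ ≡ true
≟-refl i with i ≟ i
... | yes _ = refl
... | no i≢i = ⊥-elim (i≢i refl)

≟-≢ : ∀ {n} {i j : Fin n} → i ≢ j → ⌊ i ≟ j ⌋ ≡ false
≟-≢ {i = i} {j} i≢j with i ≟ j
... | yes e = ⊥-elim (i≢j e)
... | no _ = refl

≟-sym : ∀ {n} (i j : Fin n) → ⌊ i ≟ j ⌋ ≡ ⌊ j ≟ i ⌋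
≟-sym i j with i ≟ j
... | yes refl = sym (≟-refl i)
... | no i≢j = sym (≟-≢ (≢-sym i≢j))

adj-loopless : ∀ {n} (G : Graph n) → Loopless (adj G)
adj-loopless G i rewrite ≟-refl i = refl

adj-sym : ∀ {n} (G : Graph n) → SymAdj (adj G)
adj-sym G i j rewrite ≟-sym i j | ∨-comm (rel G i j) (rel G j i) = refl

adj⇒≢ : ∀ {n} (G : Graph n) {i j} → adj G i j ≡ true → i ≢ j
adj⇒≢ G = neighbour-≢ (adj G) (adj-loopless G)

adjᶜ : ∀ {n} → Graph n → Adjacency n
adjᶜ G = adj (compl G)

adjᶜ≢ : ∀ {n} (G : Graph n) {i j} → i ≢ j → adjᶜ G i j ≡ not (adj G i j)
adjᶜ≢ G {i} {j} i≢j =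
  trans (cong (λ b → not b ∧ (not (adj G i j) ∨ not (adj G j i))) (≟-≢ i≢j))
        (trans (cong (λ x → not (adj G i j) ∨ not x) (adj-sym G j i)) (∨-idem (not (adj G i j))))
  where
  ∨-idem : ∀ b → (b ∨ b) ≡ b
  ∨-idem true = refl
  ∨-idem false = refl

compl-compl : ∀ {n} (G : Graph n) i j → adj (compl (compl G)) i j ≡ adj G i j
compl-compl G i j = by-cases (i ≟ j)
  where
  by-cases : Dec (i ≡ j) → adj (compl (compl G)) i j ≡ adj G i j
  by-cases (yes refl) = trans (adj-loopless (compl (compl G)) i) (sym (adj-loopless G i))
  by-cases (no i≢j) = trans (adjᶜ≢ (compl G) i≢j) (trans (cong not (adjᶜ≢ G i≢j)) (not-involutive _))

adjᶜ-false⇒adj : ∀ {n} (G : Graph n) {i j} → i ≢ j → adjᶜ G i j ≡ false → adj G i j ≡ true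
adjᶜ-false⇒adj G i≢j e = not-injective (trans (sym (adjᶜ≢ G i≢j)) e)

size≡edges : ∀ {n} (G : Graph n) → size G ≡ edges (adj G)
size≡edges {n} G = trans (list-sum (λ i → List.sum (map (λ j → bit (before i j ∧ adj G i j)) (allFin n))))
                         (sum-cong-≗ (λ i → list-sum (λ j → bit (before i j ∧ adj G i j))))
  where
  tabulate-sum : ∀ {m} {A : Set} (g : Fin m → A) (h : A → ℕ) → List.sum (map h (tabulate g)) ≡ sum (λ i → h (g i))
  tabulate-sum {zero} g h = refl
  tabulate-sum {suc m} g h = cong (h (g zero) +_) (tabulate-sum (λ i → g (suc i)) h)
  list-sum : (h : Fin n → ℕ) → List.sum (map h (allFin n)) ≡ sum h
  list-sum h = tabulate-sum (λ i → i) h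

handshake-graph : ∀ {n} (G : Graph n) → sum (degree (adj G)) ≡ size G + size G
handshake-graph G rewrite size≡edges G = handshake (adj G) (adj-sym G) (adj-loopless G)

pairs : ℕ → ℕ
pairs n = sum {n} (λ i → count (λ j → before i j))

size+size-compl : ∀ {n} (G : Graph n) → size G + size (compl G) ≡ pairs n
size+size-compl G rewrite size≡edges G | size≡edges (compl G) =
  trans (sym (∑-distrib-+ (λ i → count (λ j → before i j ∧ adj G i j)) (λ i → count (λ j → before i j ∧ adjᶜ G i j))))
    (sum-cong-≗ (λ i → trans (sym (∑-distrib-+ (λ j → bit (before i j ∧ adj G i j)) (λ j → bit (before i j ∧ adjᶜ G i j))))
                              (sum-cong-≗ (λ j → edge-or-non-edge i j))))
  where
  edge-or-non-edge : ∀ i j → bit (before i j ∧ adj G i j) + bit (before i j ∧ adjᶜ G i j) ≡ bit (before i j)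
  edge-or-non-edge i j with before i j in i<j
  ... | false = refl
  ... | true = trans (cong (λ x → bit (adj G i j) + bit x) (adjᶜ≢ G (before⇒≢ i<j))) (bit+bit-not (adj G i j))
    where
    bit+bit-not : ∀ b → bit b + bit (not b) ≡ 1
    bit+bit-not true = refl
    bit+bit-not false = refl

AdjIso : ∀ {n m} → Adjacency n → Adjacency m → Set
AdjIso {n} {m} a b = Σ (Fin n ↔ Fin m) λ f → ∀ i j → a i j ≡ b (Inverse.to f i) (Inverse.to f j)

AdjIso-trans : ∀ {n m k} {a : Adjacency n} {b : Adjacency m} {c : Adjacency k} → AdjIso a b → AdjIso b c → AdjIso a c
AdjIso-trans (f , f-iso) (g , g-iso) =
  mk↔ₛ′ (λ x → Inverse.to g (Inverse.to f x)) (λ y → Inverse.from f (Inverse.from g y))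
    (λ y → trans (cong (Inverse.to g) (Inverse.inverseˡ f refl)) (Inverse.inverseˡ g refl))
    (λ x → trans (cong (Inverse.from f) (Inverse.inverseʳ g refl)) (Inverse.inverseʳ f refl))
  , λ i j → trans (f-iso i j) (g-iso _ _)

AdjIso-≗ : ∀ {n m} {a : Adjacency n} {b c : Adjacency m} → AdjIso a b → (∀ i j → b i j ≡ c i j) → AdjIso a c
AdjIso-≗ (f , f-iso) b≗c = f , λ i j → trans (f-iso i j) (b≗c _ _)

to-injective : ∀ {n m} (f : Fin n ↔ Fin m) → Inj (Inverse.to f)
to-injective f {x} {y} e =
  trans (sym (Inverse.inverseʳ f refl)) (trans (cong (Inverse.from f) e) (Inverse.inverseʳ f refl))

≅-compl : ∀ {n m} (G : Graph n) (H : Graph m) → AdjIso (adjᶜ G) (adj H) → G ≅ compl H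
≅-compl G H (f , f-iso) = f , λ i j → pointwise i j (i ≟ j)
  where
  open ≡-Reasoning
  pointwise : ∀ i j → Dec (i ≡ j) → adj G i j ≡ adjᶜ H (Inverse.to f i) (Inverse.to f j)
  pointwise i j (yes refl) = trans (adj-loopless G i) (sym (adj-loopless (compl H) (Inverse.to f i)))
  pointwise i j (no i≢j) = begin
    adj G i j                                     ≡⟨ sym (not-involutive _) ⟩
    not (not (adj G i j))                         ≡⟨ cong not (sym (adjᶜ≢ G i≢j)) ⟩
    not (adjᶜ G i j)                              ≡⟨ cong not (f-iso i j) ⟩
    not (adj H (Inverse.to f i) (Inverse.to f j)) ≡⟨ sym (adjᶜ≢ H (λ e → i≢j (to-injective f e))) ⟩
    adjᶜ H (Inverse.to f i) (Inverse.to f j)      ∎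

≅-from-complements : ∀ {n m} (G : Graph n) (C T : Graph m) → AdjIso (adjᶜ G) (adj T) → (∀ i j → adj T i j ≡ adjᶜ C i j) →
                     G ≅ C
≅-from-complements G C T iso T≗Cᶜ = AdjIso-≗ (≅-compl G (compl C) (AdjIso-≗ iso T≗Cᶜ)) (compl-compl C)

+-self-injective : ∀ {x y} → x + x ≡ y + y → x ≡ y
+-self-injective {x} {y} e with <-cmp x y
... | tri< x<y _ _ = ⊥-elim (<⇒≢ (+-mono-< x<y x<y) e)
... | tri≈ _ x≡y _ = x≡y
... | tri> _ _ y<x = ⊥-elim (<⇒≢ (+-mono-< y<x y<x) (sym e))

size-≅ : ∀ {n m} (G : Graph n) (H : Graph m) → G ≅ H → size G ≡ size H
size-≅ G H (f , f-iso) = +-self-injective (begin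
    size G + size G                              ≡⟨ sym (handshake-graph G) ⟩
    sum (λ i → sum (λ j → bit (adj G i j)))       ≡⟨ sum-cong-≗ (λ i → sum-cong-≗ (λ j → cong bit (f-iso i j))) ⟩
    sum (λ i → sum (λ j → bit (adj H (F i) (F j)))) ≡⟨ sum-cong-≗ (λ i → sym (sum-permute (λ j → bit (adj H (F i) j)) f)) ⟩
    sum (λ i → sum (λ j → bit (adj H (F i) j)))   ≡⟨ sym (sum-permute (λ i → sum (λ j → bit (adj H i j))) f) ⟩
    sum (λ i → sum (λ j → bit (adj H i j)))       ≡⟨ handshake-graph H ⟩
    size H + size H                              ∎)
  where
  open ≡-Reasoning
  F = Inverse.to f


-- Book-freeness on p + 3 vertices as a domination condition on the complement

Dominates : ∀ {n} → Adjacency n → Fin n → Fin n → Fin n → Set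
Dominates a u v w = w ≢ u × w ≢ v × (a u w ∨ a v w) ≡ true

TwiceDominating : ∀ {n} → Adjacency n → Set
TwiceDominating {n} a = ∀ u v → u ≢ v → a u v ≡ false → ∃[ w₁ ] ∃[ w₂ ] w₁ ≢ w₂ × Dominates a u v w₁ × Dominates a u v w₂

common-neighbours⇒book : ∀ {n p} (G : Graph n) {u v} → adj G u v ≡ true → (g : Fin p → Fin n) → Inj g →
                         (∀ j → adj G u (g j) ≡ true × adj G v (g j) ≡ true) → Book p ⊆ G
common-neighbours⇒book {p = p} G {u} {v} uv g g-inj common = f , f-inj , f-hom
  where
  f : Fin (2 + p) → Fin _
  f zero = u
  f (suc zero) = v
  f (suc (suc j)) = g j
  g≢u : ∀ j → g j ≢ u
  g≢u j e = adj⇒≢ G (proj₁ (common j)) (sym e)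
  g≢v : ∀ j → g j ≢ v
  g≢v j e = adj⇒≢ G (proj₂ (common j)) (sym e)
  f-inj : Inj f
  f-inj {zero} {zero} e = refl
  f-inj {zero} {suc zero} e = ⊥-elim (adj⇒≢ G uv e)
  f-inj {zero} {suc (suc j)} e = ⊥-elim (g≢u j (sym e))
  f-inj {suc zero} {zero} e = ⊥-elim (adj⇒≢ G uv (sym e))
  f-inj {suc zero} {suc zero} e = refl
  f-inj {suc zero} {suc (suc j)} e = ⊥-elim (g≢v j (sym e))
  f-inj {suc (suc i)} {zero} e = ⊥-elim (g≢u i e)
  f-inj {suc (suc i)} {suc zero} e = ⊥-elim (g≢v i e)
  f-inj {suc (suc i)} {suc (suc j)} e = cong (λ x → suc (suc x)) (g-inj e)
  f-hom : ∀ i j → Adj (Book p) i j → Adj G (f i) (f j)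
  f-hom zero (suc zero) _ = uv
  f-hom zero (suc (suc j)) _ = proj₁ (common j)
  f-hom (suc zero) zero _ = trans (adj-sym G v u) uv
  f-hom (suc zero) (suc (suc j)) _ = proj₂ (common j)
  f-hom (suc (suc i)) zero _ = trans (adj-sym G (g i) u) (proj₁ (common i))
  f-hom (suc (suc i)) (suc zero) _ = trans (adj-sym G (g i) v) (proj₂ (common i))
  f-hom (suc (suc i)) (suc (suc j)) e = ⊥-elim (true≢false (trans (sym e) (∧-zeroʳ _)))

-- The pages of an embedded book are adjacent to both ends u, v of its spine, so the two vertices dominated by {u, v}
-- lie outside the book, leaving room for only p + 1 of its p + 2 vertices.
twiceDominating⇒book-free : ∀ {n} p → n ≡ 3 + p → (G : Graph n) → TwiceDominating (adjᶜ G) → ¬ (Book p ⊆ G)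
twiceDominating⇒book-free p refl G dominating (f , f-inj , f-hom) =
  1+n≰n (avoid-two f f-inj w₁≢w₂ (undominated w₁ D₁) (undominated w₂ D₂))
  where
  u = f zero
  v = f (suc zero)
  uv : adj G u v ≡ true
  uv = f-hom zero (suc zero) refl
  u≢v : u ≢ v
  u≢v = adj⇒≢ G uv
  uvᶜ : adjᶜ G u v ≡ false
  uvᶜ = trans (adjᶜ≢ G u≢v) (cong not uv)
  W = dominating u v u≢v uvᶜ
  w₁ = proj₁ W
  w₂ = proj₁ (proj₂ W)
  w₁≢w₂ = proj₁ (proj₂ (proj₂ W))
  D₁ = proj₁ (proj₂ (proj₂ (proj₂ W)))
  D₂ = proj₂ (proj₂ (proj₂ (proj₂ W)))
  undominated : ∀ w → Dominates (adjᶜ G) u v w → ∀ i → f i ≢ w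
  undominated w (w≢u , w≢v , uw∨vw) zero e = w≢u (sym e)
  undominated w (w≢u , w≢v , uw∨vw) (suc zero) e = w≢v (sym e)
  undominated w (w≢u , w≢v , uw∨vw) (suc (suc j)) refl =
    true≢false (trans (sym uw∨vw) (cong₂ _∨_ (not-adjᶜ (≢-sym w≢u) (f-hom zero (suc (suc j)) refl))
                                             (not-adjᶜ (≢-sym w≢v) (f-hom (suc zero) (suc (suc j)) refl))))
    where
    not-adjᶜ : ∀ {x y} → x ≢ y → adj G x y ≡ true → adjᶜ G x y ≡ false
    not-adjᶜ x≢y xy = trans (adjᶜ≢ G x≢y) (cong not xy)

skip-three : ∀ {p} {u v s : Fin (3 + p)} → u ≢ v → u ≢ s → v ≢ s →
             Σ (Fin p → Fin (3 + p)) λ g → Inj g × (∀ j → g j ≢ u × g j ≢ v × g j ≢ s)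
skip-three {p} {u} {v} {s} u≢v u≢s v≢s = g , g-inj , λ j → g≢u j , g≢v j , g≢s j
  where
  v′ = punchOut u≢v
  s′ = punchOut u≢s
  v′≢s′ : v′ ≢ s′
  v′≢s′ e = v≢s (punchOut-injective u≢v u≢s e)
  s″ = punchOut v′≢s′
  g : Fin p → Fin (3 + p)
  g j = punchIn u (punchIn v′ (punchIn s″ j))
  g-inj : Inj g
  g-inj e = punchIn-injective s″ _ _ (punchIn-injective v′ _ _ (punchIn-injective u _ _ e))
  g≢u : ∀ j → g j ≢ u
  g≢u j = punchInᵢ≢i u _
  g≢v : ∀ j → g j ≢ v
  g≢v j e = punchInᵢ≢i v′ _ (punchIn-injective u _ _ (trans e (sym (punchIn-punchOut u≢v))))
  g≢s : ∀ j → g j ≢ s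
  g≢s j e = punchInᵢ≢i s″ _ (punchIn-injective v′ _ _
              (trans (punchIn-injective u _ _ (trans e (sym (punchIn-punchOut u≢s)))) (sym (punchIn-punchOut v′≢s′))))

third-vertex : ∀ {p} {u v : Fin (3 + p)} → u ≢ v → ∃[ s ] u ≢ s × v ≢ s
third-vertex {u = u} {v} u≢v =
  s , (λ e → punchInᵢ≢i u _ (sym e)) , λ e → punchInᵢ≢i (punchOut u≢v) zero (punchIn-injective u _ _ (trans (sym e) (sym (punchIn-punchOut u≢v))))
  where s = punchIn u (punchIn (punchOut u≢v) zero)

two-or-at-most-one : ∀ {n} (f : Fin n → Bool) (s₀ : Fin n) →
  (∃[ x ] ∃[ y ] x ≢ y × f x ≡ true × f y ≡ true) ⊎ (∃[ s ] (∀ w → w ≢ s → f w ≡ false) × (f s ≡ true ⊎ s ≡ s₀))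
two-or-at-most-one f s₀ with 2 ≤? count f
... | yes h = inj₁ (count-witnesses₂ f h)
... | no h with 1 ≤? count f
...   | no h′ = inj₂ (s₀ , (λ w _ → none w) , inj₂ refl)
  where
  none : ∀ w → f w ≡ false
  none w with f w in fw
  ... | false = refl
  ... | true = ⊥-elim (h′ (count≥1 f fw))
...   | yes h′ with count-witness f h′
...     | s , fs = inj₂ (s , only , inj₁ fs)
  where
  only : ∀ w → w ≢ s → f w ≡ false
  only w w≢s with f w in fw
  ... | false = refl
  ... | true = ⊥-elim (w≢s (count≤1-unique f (s≤s⁻¹ (≰⇒> h)) fw fs))

book-free⇒twiceDominating : ∀ {n} p → n ≡ 3 + p → (G : Graph n) → ¬ (Book p ⊆ G) → TwiceDominating (adjᶜ G)
book-free⇒twiceDominating p refl G book-free u v u≢v uvᶜ = by-count (two-or-at-most-one dominated (proj₁ third))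
  where
  uv : adj G u v ≡ true
  uv = adjᶜ-false⇒adj G u≢v uvᶜ
  third = third-vertex u≢v
  dominated : Fin (3 + p) → Bool
  dominated w = not ⌊ w ≟ u ⌋ ∧ (not ⌊ w ≟ v ⌋ ∧ (adjᶜ G u w ∨ adjᶜ G v w))
  dominated-≡ : ∀ {w} → w ≢ u → w ≢ v → dominated w ≡ (adjᶜ G u w ∨ adjᶜ G v w)
  dominated-≡ w≢u w≢v rewrite ≟-≢ w≢u | ≟-≢ w≢v = refl
  dominates : ∀ {w} → dominated w ≡ true → Dominates (adjᶜ G) u v w
  dominates {w} e with w ≟ u | w ≟ v
  dominates {w} () | yes _ | _
  dominates {w} () | no _ | yes _
  dominates {w} e | no w≢u | no w≢v = w≢u , w≢v , e
  -- If at most s is dominated, every vertex other than u, v, s is a common neighbour of u and v.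
  book-of-rest : ∀ s → u ≢ s → v ≢ s → (∀ w → w ≢ s → dominated w ≡ false) → ⊥
  book-of-rest s u≢s v≢s rest = book-free (common-neighbours⇒book G uv g g-inj common)
    where
    skip = skip-three u≢v u≢s v≢s
    g = proj₁ skip
    g-inj = proj₁ (proj₂ skip)
    common : ∀ j → adj G u (g j) ≡ true × adj G v (g j) ≡ true
    common j with proj₂ (proj₂ skip) j
    ... | g≢u , g≢v , g≢s =
      adjᶜ-false⇒adj G (≢-sym g≢u) (∨-conicalˡ _ _ none) , adjᶜ-false⇒adj G (≢-sym g≢v) (∨-conicalʳ _ _ none)
      where none = trans (sym (dominated-≡ g≢u g≢v)) (rest (g j) g≢s)
  by-count : _ → ∃[ w₁ ] ∃[ w₂ ] w₁ ≢ w₂ × Dominates (adjᶜ G) u v w₁ × Dominates (adjᶜ G) u v w₂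
  by-count (inj₁ (x , y , x≢y , dx , dy)) = x , y , x≢y , dominates dx , dominates dy
  by-count (inj₂ (s , rest , inj₁ ds)) =
    ⊥-elim (book-of-rest s (λ e → proj₁ (dominates ds) (sym e)) (λ e → proj₁ (proj₂ (dominates ds)) (sym e)) rest)
  by-count (inj₂ (s , rest , inj₂ refl)) = ⊥-elim (book-of-rest s (proj₁ (proj₂ third)) (proj₂ (proj₂ third)) rest)

-- Degree sums of twice dominating relations

≥2-or-≤1 : ∀ k → 2 ≤ k ⊎ k ≤ 1
≥2-or-≤1 k with 2 ≤? k
... | yes h = inj₁ h
... | no h = inj₂ (s≤s⁻¹ (≰⇒> h))

+≡⇒≤ : ∀ {A B} k → A + k ≡ B → A ≤ B
+≡⇒≤ {A} k e = subst (A ≤_) e (m≤m+n A k)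

≡suc+⇒≰ : ∀ {A B} k → A ≡ suc (B + k) → A ≤ B → ⊥
≡suc+⇒≰ {A} {B} k e h = 1+n≰n (≤-trans (m≤m+n (suc B) k) (≤-trans (≤-reflexive (sym e)) h))

double≢suc-double : ∀ x y → x + x ≢ suc (y + y)
double≢suc-double zero y ()
double≢suc-double (suc x) zero e = 1+n≢0 (trans (sym (+-suc x x)) (suc-injective e))
double≢suc-double (suc x) (suc y) e =
  double≢suc-double x y (suc-injective (trans (sym (+-suc x x)) (trans (suc-injective e) (cong suc (+-suc y y)))))

module Domination {n} (a : Adjacency (suc n)) (sym-a : SymAdj a) (loopless : Loopless a) (dominating : TwiceDominating a) where

  d : Fin (suc n) → ℕ
  d = degree a

  neighbour-≢′ : ∀ {v w} → a v w ≡ true → v ≢ w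
  neighbour-≢′ = neighbour-≢ a loopless

  leaves-share-no-neighbour : ∀ {x y w} → d x ≤ 1 → d y ≤ 1 → x ≢ y → a x w ≡ true → a y w ≡ true → ⊥
  leaves-share-no-neighbour {x} {y} {w} dx dy x≢y xw yw with a x y in xy
  ... | true = neighbour-≢′ yw (degree≤1-unique a dx xy xw)
  ... | false with dominating x y x≢y xy
  ...   | w₁ , w₂ , w₁≢w₂ , (_ , _ , d₁) , (_ , _ , d₂) = w₁≢w₂ (trans (only-w w₁ d₁) (sym (only-w w₂ d₂)))
    where
    only-w : ∀ z → (a x z ∨ a y z) ≡ true → z ≡ w
    only-w z e with a x z in xz
    ... | true = degree≤1-unique a dx xz xw
    ... | false = degree≤1-unique a dy e yw

  non-leaf-among : ∀ {w p q} → p ≢ q → a w p ≡ true → a w q ≡ true → 2 ≤ d p ⊎ 2 ≤ d q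
  non-leaf-among {w} {p} {q} p≢q wp wq with ≥2-or-≤1 (d p) | ≥2-or-≤1 (d q)
  ... | inj₁ h | _ = inj₁ h
  ... | inj₂ _ | inj₁ h = inj₂ h
  ... | inj₂ hp | inj₂ hq = ⊥-elim (leaves-share-no-neighbour hp hq p≢q (trans (sym-a p w) wp) (trans (sym-a q w) wq))

  non-leaf-neighbour : ∀ {w} → 2 ≤ d w → ∃[ w′ ] a w w′ ≡ true × 2 ≤ d w′
  non-leaf-neighbour {w} h with count-witnesses₂ (a w) h
  ... | p , q , p≢q , wp , wq with non-leaf-among p≢q wp wq
  ...   | inj₁ hp = p , wp , hp
  ...   | inj₂ hq = q , wq , hq

  two-non-leaf-neighbours : ∀ {w} → 3 ≤ d w → ∃[ p ] ∃[ q ] p ≢ q × a w p ≡ true × a w q ≡ true × 2 ≤ d p × 2 ≤ d q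
  two-non-leaf-neighbours {w} h = among (count-witnesses₃ (a w) h)
    where
    among : ∃[ x ] ∃[ y ] ∃[ z ] x ≢ y × x ≢ z × y ≢ z × a w x ≡ true × a w y ≡ true × a w z ≡ true →
            ∃[ p ] ∃[ q ] p ≢ q × a w p ≡ true × a w q ≡ true × 2 ≤ d p × 2 ≤ d q
    among (x , y , z , x≢y , x≢z , y≢z , wx , wy , wz) =
      pick (non-leaf-among x≢y wx wy) (non-leaf-among x≢z wx wz) (non-leaf-among y≢z wy wz)
      where
      pick : 2 ≤ d x ⊎ 2 ≤ d y → 2 ≤ d x ⊎ 2 ≤ d z → 2 ≤ d y ⊎ 2 ≤ d z →
             ∃[ p ] ∃[ q ] p ≢ q × a w p ≡ true × a w q ≡ true × 2 ≤ d p × 2 ≤ d q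
      pick (inj₁ hx) _ (inj₁ hy) = x , y , x≢y , wx , wy , hx , hy
      pick (inj₁ hx) _ (inj₂ hz) = x , z , x≢z , wx , wz , hx , hz
      pick (inj₂ hy) (inj₁ hx) _ = x , y , x≢y , wx , wy , hx , hy
      pick (inj₂ hy) (inj₂ hz) _ = y , z , y≢z , wy , wz , hy , hz

  isolated⇒degree≥2 : ∀ {u} → d u ≡ 0 → ∀ v → v ≢ u → 2 ≤ d v
  isolated⇒degree≥2 {u} du v v≢u with a u v in uv
  ... | true = ⊥-elim (1+n≰n (≤-trans (count≥1 (a u) uv) (≤-reflexive du)))
  ... | false with dominating u v (≢-sym v≢u) uv
  ...   | w₁ , w₂ , w₁≢w₂ , (_ , _ , d₁) , (_ , _ , d₂) = count≥2 (a v) w₁≢w₂ (via-v w₁ d₁) (via-v w₂ d₂)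
    where
    via-v : ∀ z → (a u z ∨ a v z) ≡ true → a v z ≡ true
    via-v z e with a u z in uz
    ... | true = ⊥-elim (1+n≰n (≤-trans (count≥1 (a u) uz) (≤-reflexive du)))
    ... | false = e

  isolated⇒degree-sum≥ : ∀ {u} → d u ≡ 0 → n + n ≤ sum d
  isolated⇒degree-sum≥ {u} du =
    ≤-trans (double-length≤sum (λ x → d (punchIn u x)) (λ x → isolated⇒degree≥2 du (punchIn u x) (punchInᵢ≢i u x)))
            (≤-trans (m≤n+m _ (d u)) (≤-reflexive (sym (sum-remove {i = u} d))))

module OrderBound (m : ℕ) (a : Adjacency (3 + m)) (sym-a : SymAdj a) (loopless : Loopless a) (dominating : TwiceDominating a) where
  open Domination a sym-a loopless dominating

  order≤degree-sum : 3 + m ≤ sum d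
  order≤degree-sum with isolated-or-positive a
  ... | inj₁ (u , du) = ≤-trans (+≡⇒≤ (1 + m) (ar m)) (isolated⇒degree-sum≥ du)
    where
    ar : ∀ m → 3 + m + (1 + m) ≡ (2 + m) + (2 + m)
    ar = solve-∀
  ... | inj₂ positive = length≤sum d positive

  degree-sum≡order⇒matching : sum d ≡ 3 + m → ∀ v → HasUniqueNeighbour a v
  degree-sum≡order⇒matching ∑d≡ v with isolated-or-positive a
  ... | inj₁ (u , du) = ⊥-elim (≡suc+⇒≰ m (ar m) (≤-trans (isolated⇒degree-sum≥ du) (≤-reflexive ∑d≡)))
    where
    ar : ∀ m → (2 + m) + (2 + m) ≡ suc (3 + m + m)
    ar = solve-∀
  ... | inj₂ positive = degree≡1⇒unique a (positive v) (leaf (≥2-or-≤1 (d v)))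
    where
    leaf : 2 ≤ d v ⊎ d v ≤ 1 → d v ≤ 1
    leaf (inj₂ h) = h
    leaf (inj₁ h) = ⊥-elim (≡suc+⇒≰ 0 (ar m) (≤-trans (+-monoˡ-≤ (2 + m) h) (≤-trans (sum≥₁ d positive v) (≤-reflexive ∑d≡))))
      where
      ar : ∀ m → 2 + (2 + m) ≡ suc (3 + m + 0)
      ar = solve-∀

record TriangleShape {n} (a : Adjacency n) : Set where
  field
    x y z : Fin n
    x≢y : x ≢ y
    x≢z : x ≢ z
    y≢z : y ≢ z
    xy : a x y ≡ true
    xz : a x z ≡ true
    yz : a y z ≡ true
    dx : degree a x ≤ 2
    dy : degree a y ≤ 2
    dz : degree a z ≤ 2
    others : ∀ v → v ≢ x → v ≢ y → v ≢ z → degree a v ≤ 1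
    positive : ∀ v → 1 ≤ degree a v

record P₅Shape {n} (a : Adjacency n) : Set where
  field
    l₁ x y z l₂ : Fin n
    l₁≢x : l₁ ≢ x
    l₁≢y : l₁ ≢ y
    l₁≢z : l₁ ≢ z
    l₁≢l₂ : l₁ ≢ l₂
    x≢y : x ≢ y
    x≢z : x ≢ z
    x≢l₂ : x ≢ l₂
    y≢z : y ≢ z
    y≢l₂ : y ≢ l₂
    z≢l₂ : z ≢ l₂
    l₁x : a l₁ x ≡ true
    xy : a x y ≡ true
    yz : a y z ≡ true
    zl₂ : a z l₂ ≡ true
    dx : degree a x ≤ 2
    dy : degree a y ≤ 2
    dz : degree a z ≤ 2
    others : ∀ v → v ≢ x → v ≢ y → v ≢ z → degree a v ≤ 1
    positive : ∀ v → 1 ≤ degree a v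

module OddOrderBound (m : ℕ) (a : Adjacency (5 + m)) (sym-a : SymAdj a) (loopless : Loopless a) (dominating : TwiceDominating a) where
  open Domination a sym-a loopless dominating

  module Positive (positive : ∀ v → 1 ≤ d v) where

    two-heavy⇒degree-sum≥ : ∀ {w v} → w ≢ v → 2 ≤ d w → 2 ≤ d v → 7 + m ≤ sum d
    two-heavy⇒degree-sum≥ {w} {v} w≢v hw hv =
      ≤-trans (≤-reflexive (ar m)) (≤-trans (+-mono-≤ hw (+-monoˡ-≤ (3 + m) hv)) (sum≥₂ d positive w v w≢v))
      where
      ar : ∀ m → 7 + m ≡ 2 + (2 + (3 + m))
      ar = solve-∀

    three-heavy⇒degree-sum≥ : ∀ {w p q} → w ≢ p → w ≢ q → p ≢ q → 3 ≤ d w → 2 ≤ d p → 2 ≤ d q → 9 + m ≤ sum d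
    three-heavy⇒degree-sum≥ {w} {p} {q} w≢p w≢q p≢q hw hp hq =
      ≤-trans (≤-reflexive (ar m)) (≤-trans (+-mono-≤ hw (+-mono-≤ hp (+-monoˡ-≤ (2 + m) hq))) (sum≥₃ d positive w p q w≢p w≢q p≢q))
      where
      ar : ∀ m → 9 + m ≡ 3 + (2 + (2 + (2 + m)))
      ar = solve-∀

    four-heavy⇒degree-sum≥ : ∀ {p q r s} → p ≢ q → p ≢ r → p ≢ s → q ≢ r → q ≢ s → r ≢ s →
                             2 ≤ d p → 2 ≤ d q → 2 ≤ d r → 2 ≤ d s → 9 + m ≤ sum d
    four-heavy⇒degree-sum≥ {p} {q} {r} {s} p≢q p≢r p≢s q≢r q≢s r≢s hp hq hr hs =
      ≤-trans (≤-reflexive (ar m))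
              (≤-trans (+-mono-≤ hp (+-mono-≤ hq (+-mono-≤ hr (+-monoˡ-≤ (1 + m) hs)))) (sum≥₄ d positive p q r s p≢q p≢r p≢s q≢r q≢s r≢s))
      where
      ar : ∀ m → 9 + m ≡ 2 + (2 + (2 + (2 + (1 + m))))
      ar = solve-∀

    exceeds : sum d ≡ 8 + m → 9 + m ≤ sum d → ⊥
    exceeds ∑d≡ le = 1+n≰n (subst (9 + m ≤_) ∑d≡ le)

    degree-sum≢order+1 : sum d ≢ 6 + m
    degree-sum≢order+1 ∑d≡ with length<sum⇒≥2 d (≤-reflexive (sym ∑d≡))
    ... | w , dw≥2 with count-witnesses₂ (a w) dw≥2
    ...   | x , y , x≢y , wx , wy with non-leaf-among x≢y wx wy
    ...     | inj₁ dx≥2 = 1+n≰n (subst (7 + m ≤_) ∑d≡ (two-heavy⇒degree-sum≥ (neighbour-≢′ wx) dw≥2 dx≥2))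
    ...     | inj₂ dy≥2 = 1+n≰n (subst (7 + m ≤_) ∑d≡ (two-heavy⇒degree-sum≥ (neighbour-≢′ wy) dw≥2 dy≥2))

    degree≤2 : sum d ≡ 8 + m → ∀ w → d w ≤ 2
    degree≤2 ∑d≡ w = by-cases (3 ≤? d w)
      where
      by-cases : Dec (3 ≤ d w) → d w ≤ 2
      by-cases (no h) = s≤s⁻¹ (≰⇒> h)
      by-cases (yes h) = case two-non-leaf-neighbours h of λ where
        (p , q , p≢q , wp , wq , hp , hq) → ⊥-elim (exceeds ∑d≡ (three-heavy⇒degree-sum≥ (neighbour-≢′ wp) (neighbour-≢′ wq) p≢q h hp hq))

    path-shape : ∀ {x y z} → x ≢ y → x ≢ z → y ≢ z → a x y ≡ true → a y z ≡ true → a x z ≡ false →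
                 d x ≤ 2 → d y ≤ 2 → d z ≤ 2 → 2 ≤ d x → 2 ≤ d z → (∀ v → v ≢ x → v ≢ y → v ≢ z → d v ≤ 1) → P₅Shape a
    path-shape {x} {y} {z} x≢y x≢z y≢z xy yz xz dx dy dz hx hz others =
      with-leaves (another-neighbour a hx y) (another-neighbour a hz y)
      where
      with-leaves : ∃[ l₁ ] a x l₁ ≡ true × l₁ ≢ y → ∃[ l₂ ] a z l₂ ≡ true × l₂ ≢ y → P₅Shape a
      with-leaves (l₁ , xl₁ , l₁≢y) (l₂ , zl₂ , l₂≢y) = record
        { l₁ = l₁ ; x = x ; y = y ; z = z ; l₂ = l₂
        ; l₁≢x = ≢-sym (neighbour-≢′ xl₁) ; l₁≢y = l₁≢y ; l₁≢z = l₁≢z ; l₁≢l₂ = l₁≢l₂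
        ; x≢y = x≢y ; x≢z = x≢z ; x≢l₂ = ≢-sym l₂≢x ; y≢z = y≢z ; y≢l₂ = ≢-sym l₂≢y ; z≢l₂ = neighbour-≢′ zl₂
        ; l₁x = trans (sym-a l₁ x) xl₁ ; xy = xy ; yz = yz ; zl₂ = zl₂
        ; dx = dx ; dy = dy ; dz = dz ; others = others ; positive = positive }
        where
        l₁≢z : l₁ ≢ z
        l₁≢z refl = true≢false (trans (sym xl₁) xz)
        l₂≢x : l₂ ≢ x
        l₂≢x refl = true≢false (trans (sym zl₂) (trans (sym-a z x) xz))
        l₁≢l₂ : l₁ ≢ l₂
        l₁≢l₂ refl = x≢z (degree≤1-unique a (others l₁ (≢-sym (neighbour-≢′ xl₁)) l₁≢y l₁≢z)
                                            (trans (sym-a l₁ x) xl₁) (trans (sym-a l₁ z) zl₂))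

    record HeavyVertices : Set where
      field
        w₁ w₂ w₃ : Fin (5 + m)
        w₁≢w₂ : w₁ ≢ w₂
        w₁≢w₃ : w₁ ≢ w₃
        w₂≢w₃ : w₂ ≢ w₃
        w₁w₂ : a w₁ w₂ ≡ true
        h₁ : 2 ≤ d w₁
        h₂ : 2 ≤ d w₂
        h₃ : 2 ≤ d w₃
        rest : ∀ v → v ≢ w₁ → v ≢ w₂ → v ≢ w₃ → d v ≤ 1

    heavy-vertices : sum d ≡ 8 + m → HeavyVertices
    heavy-vertices ∑d≡ = from-w₁ (length<sum⇒≥2 d (≤-trans (+≡⇒≤ 2 (ar m)) (≤-reflexive (sym ∑d≡))))
      where
      ar : ∀ m → suc (5 + m) + 2 ≡ 8 + m
      ar = solve-∀
      light : ∀ v → 2 ≤ d v ⊎ d v ≤ 1 → (2 ≤ d v → ⊥) → d v ≤ 1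
      light v (inj₁ hv) heavy = ⊥-elim (heavy hv)
      light v (inj₂ hv) _ = hv
      from-w₃ : ∀ {w₁ w₂} → a w₁ w₂ ≡ true → 2 ≤ d w₁ → 2 ≤ d w₂ → ∃[ w₃ ] w₃ ≢ w₁ × w₃ ≢ w₂ × 2 ≤ d w₃ → HeavyVertices
      from-w₃ {w₁} {w₂} w₁w₂ h₁ h₂ (w₃ , w₃≢w₁ , w₃≢w₂ , h₃) = record
        { w₁ = w₁ ; w₂ = w₂ ; w₃ = w₃ ; w₁≢w₂ = neighbour-≢′ w₁w₂ ; w₁≢w₃ = ≢-sym w₃≢w₁ ; w₂≢w₃ = ≢-sym w₃≢w₂
        ; w₁w₂ = w₁w₂ ; h₁ = h₁ ; h₂ = h₂ ; h₃ = h₃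
        ; rest = λ v v≢w₁ v≢w₂ v≢w₃ → light v (≥2-or-≤1 (d v))
                   (λ hv → exceeds ∑d≡ (four-heavy⇒degree-sum≥ (neighbour-≢′ w₁w₂) (≢-sym w₃≢w₁) (≢-sym v≢w₁)
                                                              (≢-sym w₃≢w₂) (≢-sym v≢w₂) (≢-sym v≢w₃) h₁ h₂ h₃ hv)) }
      from-w₂ : ∀ {w₁} → 2 ≤ d w₁ → ∃[ w₂ ] a w₁ w₂ ≡ true × 2 ≤ d w₂ → HeavyVertices
      from-w₂ {w₁} h₁ (w₂ , w₁w₂ , h₂) = from-w₃ w₁w₂ h₁ h₂ (sum>₂⇒≥2 d w₁ w₂ (neighbour-≢′ w₁w₂)
        (≤-trans (s≤s (+-mono-≤ (degree≤2 ∑d≡ w₁) (+-monoˡ-≤ (3 + m) (degree≤2 ∑d≡ w₂)))) (≤-reflexive (sym ∑d≡))))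
      from-w₁ : ∃[ w₁ ] 2 ≤ d w₁ → HeavyVertices
      from-w₁ (w₁ , h₁) = from-w₂ h₁ (non-leaf-neighbour h₁)

    shape : sum d ≡ 8 + m → TriangleShape a ⊎ P₅Shape a
    shape ∑d≡ = by-edges (a w₁ w₃) refl (a w₂ w₃) refl
      where
      open HeavyVertices (heavy-vertices ∑d≡)
      ≤2 = degree≤2 ∑d≡
      by-edges : ∀ b₁₃ → a w₁ w₃ ≡ b₁₃ → ∀ b₂₃ → a w₂ w₃ ≡ b₂₃ → TriangleShape a ⊎ P₅Shape a
      by-edges true w₁w₃ true w₂w₃ = inj₁ (record
        { x = w₁ ; y = w₂ ; z = w₃ ; x≢y = w₁≢w₂ ; x≢z = w₁≢w₃ ; y≢z = w₂≢w₃ ; xy = w₁w₂ ; xz = w₁w₃ ; yz = w₂w₃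
        ; dx = ≤2 w₁ ; dy = ≤2 w₂ ; dz = ≤2 w₃ ; others = rest ; positive = positive })
      by-edges true w₁w₃ false w₂w₃ = inj₂ (path-shape (≢-sym w₁≢w₂) w₂≢w₃ w₁≢w₃ (trans (sym-a w₂ w₁) w₁w₂) w₁w₃ w₂w₃
        (≤2 w₂) (≤2 w₁) (≤2 w₃) h₂ h₃ (λ v v≢w₂ v≢w₁ v≢w₃ → rest v v≢w₁ v≢w₂ v≢w₃))
      by-edges false w₁w₃ true w₂w₃ = inj₂ (path-shape w₁≢w₂ w₁≢w₃ w₂≢w₃ w₁w₂ w₂w₃ w₁w₃ (≤2 w₁) (≤2 w₂) (≤2 w₃) h₁ h₃ rest)
      by-edges false w₁w₃ false w₂w₃ = ⊥-elim (two-leaves (count-witnesses₂ (a w₃) h₃))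
        where
        leaf-neighbour : ∀ {q} → a w₃ q ≡ true → d q ≤ 1
        leaf-neighbour {q} w₃q = rest q q≢w₁ q≢w₂ (≢-sym (neighbour-≢′ w₃q))
          where
          q≢w₁ : q ≢ w₁
          q≢w₁ refl = true≢false (trans (sym w₃q) (trans (sym-a w₃ w₁) w₁w₃))
          q≢w₂ : q ≢ w₂
          q≢w₂ refl = true≢false (trans (sym w₃q) (trans (sym-a w₃ w₂) w₂w₃))
        two-leaves : ∃[ q₁ ] ∃[ q₂ ] q₁ ≢ q₂ × a w₃ q₁ ≡ true × a w₃ q₂ ≡ true → ⊥
        two-leaves (q₁ , q₂ , q₁≢q₂ , w₃q₁ , w₃q₂) =
          leaves-share-no-neighbour (leaf-neighbour w₃q₁) (leaf-neighbour w₃q₂) q₁≢q₂ (trans (sym-a q₁ w₃) w₃q₁) (trans (sym-a q₂ w₃) w₃q₂)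

    -- The degree sum is even while the order is odd, so it cannot be order + 0 or order + 2.
    order+3≤degree-sum⁺ : ∀ q → 5 + m ≡ suc (q + q) → 8 + m ≤ sum d
    order+3≤degree-sum⁺ q odd = by-excess (sum d ∸ (5 + m)) (sym (m+[n∸m]≡n (length≤sum d positive)))
      where
      E = edges a
      even : sum d ≡ E + E
      even = handshake a sym-a loopless
      ar₁ : ∀ m → (5 + m) + 1 ≡ 6 + m
      ar₁ = solve-∀
      ar₂ : ∀ q → suc (q + q) + 2 ≡ suc (suc q + suc q)
      ar₂ = solve-∀
      ar₃ : ∀ m k → 8 + m + k ≡ (5 + m) + (3 + k)
      ar₃ = solve-∀
      by-excess : ∀ k → sum d ≡ (5 + m) + k → 8 + m ≤ sum d
      by-excess 0 e = ⊥-elim (double≢suc-double E q (trans (sym even) (trans e (trans (+-identityʳ _) odd))))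
      by-excess 1 e = ⊥-elim (degree-sum≢order+1 (trans e (ar₁ m)))
      by-excess 2 e = ⊥-elim (double≢suc-double E (suc q) (trans (sym even) (trans e (trans (cong (_+ 2) odd) (ar₂ q)))))
      by-excess (suc (suc (suc k))) e = ≤-trans (+≡⇒≤ k (ar₃ m k)) (≤-reflexive (sym e))

  order+3≤degree-sum : ∀ q → 5 + m ≡ suc (q + q) → 8 + m ≤ sum d
  order+3≤degree-sum q odd with isolated-or-positive a
  ... | inj₁ (u , du) = ≤-trans (+≡⇒≤ m (ar m)) (isolated⇒degree-sum≥ du)
    where
    ar : ∀ m → 8 + m + m ≡ (4 + m) + (4 + m)
    ar = solve-∀
  ... | inj₂ positive = Positive.order+3≤degree-sum⁺ positive q odd

  degree-sum≡order+3⇒shape : sum d ≡ 8 + m → (∃[ u ] d u ≡ 0) × m ≡ 0 ⊎ TriangleShape a ⊎ P₅Shape a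
  degree-sum≡order+3⇒shape ∑d≡ with isolated-or-positive a
  ... | inj₁ (u , du) = inj₁ ((u , du) , n≤0⇒n≡0 (+-cancelˡ-≤ (8 + m) m 0 (≤-trans (≤-reflexive (sym (ar m)))
                                  (≤-trans (isolated⇒degree-sum≥ du) (≤-reflexive (trans ∑d≡ (sym (+-identityʳ _))))))))
    where
    ar : ∀ m → (4 + m) + (4 + m) ≡ (8 + m) + m
    ar = solve-∀
  ... | inj₂ positive = inj₂ (Positive.shape positive ∑d≡)

order≤degree-sum : ∀ {n} m → n ≡ 3 + m → (a : Adjacency n) → SymAdj a → Loopless a → TwiceDominating a → 3 + m ≤ sum (degree a)
order≤degree-sum m refl = OrderBound.order≤degree-sum m

degree-sum≡order⇒matching : ∀ {n} m → n ≡ 3 + m → (a : Adjacency n) → SymAdj a → Loopless a → TwiceDominating a →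
                            sum (degree a) ≡ 3 + m → ∀ v → HasUniqueNeighbour a v
degree-sum≡order⇒matching m refl = OrderBound.degree-sum≡order⇒matching m

order+3≤degree-sum : ∀ {n} m → n ≡ 5 + m → (a : Adjacency n) → SymAdj a → Loopless a → TwiceDominating a →
                     ∀ q → 5 + m ≡ suc (q + q) → 8 + m ≤ sum (degree a)
order+3≤degree-sum m refl = OddOrderBound.order+3≤degree-sum m

degree-sum≡order+3⇒shape : ∀ {n} m → n ≡ 5 + m → (a : Adjacency n) → SymAdj a → Loopless a → TwiceDominating a →
                           sum (degree a) ≡ 8 + m → (∃[ u ] degree a u ≡ 0) × m ≡ 0 ⊎ TriangleShape a ⊎ P₅Shape a
degree-sum≡order+3⇒shape m refl = OddOrderBound.degree-sum≡order+3⇒shape m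

≟-injective : ∀ {m n} (f : Fin m → Fin n) → Inj f → ∀ x y → ⌊ f x ≟ f y ⌋ ≡ ⌊ x ≟ y ⌋
≟-injective f f-inj x y with x ≟ y
... | yes refl = ≟-refl (f x)
... | no x≢y = ≟-≢ (λ e → x≢y (f-inj e))

↑ˡ≢↑ʳ : ∀ t r (c : Fin t) (y : Fin r) → c ↑ˡ r ≢ t ↑ʳ y
↑ˡ≢↑ʳ t r c y e with trans (sym (splitAt-↑ˡ t c r)) (trans (cong (splitAt t) e) (splitAt-↑ʳ t r y))
... | ()

↑-view : ∀ t r (i : Fin (t + r)) → (∃[ c ] i ≡ c ↑ˡ r) ⊎ (∃[ y ] i ≡ t ↑ʳ y)
↑-view t r i with splitAt t i in e
... | inj₁ c = inj₁ (c , sym (splitAt⁻¹-↑ˡ e))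
... | inj₂ y = inj₂ (y , sym (splitAt⁻¹-↑ʳ e))

module _ {t r : ℕ} (X : Graph t) (Y : Graph r) where

  ⊕-adj-ll : ∀ c c' → adj (X ⊕ Y) (c ↑ˡ r) (c' ↑ˡ r) ≡ adj X c c'
  ⊕-adj-ll c c' rewrite ≟-injective (_↑ˡ r) (↑ˡ-injective r _ _) c c' | splitAt-↑ˡ t c r | splitAt-↑ˡ t c' r = refl

  ⊕-adj-rr : ∀ y y' → adj (X ⊕ Y) (t ↑ʳ y) (t ↑ʳ y') ≡ adj Y y y'
  ⊕-adj-rr y y' rewrite ≟-injective (t ↑ʳ_) (↑ʳ-injective t _ _) y y' | splitAt-↑ʳ t r y | splitAt-↑ʳ t r y' = refl

  ⊕-adj-lr : ∀ c y → adj (X ⊕ Y) (c ↑ˡ r) (t ↑ʳ y) ≡ false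
  ⊕-adj-lr c y rewrite splitAt-↑ˡ t c r | splitAt-↑ʳ t r y = ∧-zeroʳ _

  ⊕-adj-rl : ∀ y c → adj (X ⊕ Y) (t ↑ʳ y) (c ↑ˡ r) ≡ false
  ⊕-adj-rl y c rewrite splitAt-↑ˡ t c r | splitAt-↑ʳ t r y = ∧-zeroʳ _

  ∨G-adj-ll : ∀ c c' → adj (X ∨G Y) (c ↑ˡ r) (c' ↑ˡ r) ≡ adj X c c'
  ∨G-adj-ll c c' rewrite ≟-injective (_↑ˡ r) (↑ˡ-injective r _ _) c c' | splitAt-↑ˡ t c r | splitAt-↑ˡ t c' r = refl

  ∨G-adj-rr : ∀ y y' → adj (X ∨G Y) (t ↑ʳ y) (t ↑ʳ y') ≡ adj Y y y'
  ∨G-adj-rr y y' rewrite ≟-injective (t ↑ʳ_) (↑ʳ-injective t _ _) y y' | splitAt-↑ʳ t r y | splitAt-↑ʳ t r y' = refl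

  ∨G-adj-lr : ∀ c y → adj (X ∨G Y) (c ↑ˡ r) (t ↑ʳ y) ≡ true
  ∨G-adj-lr c y rewrite splitAt-↑ˡ t c r | splitAt-↑ʳ t r y | ≟-≢ (↑ˡ≢↑ʳ t r c y) = refl

  ∨G-adj-rl : ∀ y c → adj (X ∨G Y) (t ↑ʳ y) (c ↑ˡ r) ≡ true
  ∨G-adj-rl y c rewrite splitAt-↑ˡ t c r | splitAt-↑ʳ t r y | ≟-≢ (≢-sym (↑ˡ≢↑ʳ t r c y)) = refl

⊕-cong : ∀ {t r} (A A' : Graph t) (B B' : Graph r) → (∀ i j → adj A i j ≡ adj A' i j) → (∀ i j → adj B i j ≡ adj B' i j) →
         ∀ i j → adj (A ⊕ B) i j ≡ adj (A' ⊕ B') i j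
⊕-cong {t} {r} A A' B B' A≗A' B≗B' i j = by-sides (↑-view t r i) (↑-view t r j)
  where
  by-sides : (∃[ c ] i ≡ c ↑ˡ r) ⊎ (∃[ y ] i ≡ t ↑ʳ y) → (∃[ c ] j ≡ c ↑ˡ r) ⊎ (∃[ y ] j ≡ t ↑ʳ y) →
             adj (A ⊕ B) i j ≡ adj (A' ⊕ B') i j
  by-sides (inj₁ (c , refl)) (inj₁ (c' , refl)) = trans (⊕-adj-ll A B c c') (trans (A≗A' c c') (sym (⊕-adj-ll A' B' c c')))
  by-sides (inj₁ (c , refl)) (inj₂ (y , refl)) = trans (⊕-adj-lr A B c y) (sym (⊕-adj-lr A' B' c y))
  by-sides (inj₂ (y , refl)) (inj₁ (c , refl)) = trans (⊕-adj-rl A B y c) (sym (⊕-adj-rl A' B' y c))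
  by-sides (inj₂ (y , refl)) (inj₂ (y' , refl)) = trans (⊕-adj-rr A B y y') (trans (B≗B' y y') (sym (⊕-adj-rr A' B' y y')))

compl-∨G : ∀ {t r} (A : Graph t) (B : Graph r) → ∀ i j → adjᶜ (A ∨G B) i j ≡ adj (compl A ⊕ compl B) i j
compl-∨G {t} {r} A B i j = by-sides (↑-view t r i) (↑-view t r j)
  where
  open ≡-Reasoning
  by-sides : (∃[ c ] i ≡ c ↑ˡ r) ⊎ (∃[ y ] i ≡ t ↑ʳ y) → (∃[ c ] j ≡ c ↑ˡ r) ⊎ (∃[ y ] j ≡ t ↑ʳ y) →
             adjᶜ (A ∨G B) i j ≡ adj (compl A ⊕ compl B) i j
  by-sides (inj₁ (c , refl)) (inj₁ (c' , refl)) with c ≟ c'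
  ... | yes refl = trans (adj-loopless (compl (A ∨G B)) (c ↑ˡ r)) (sym (adj-loopless (compl A ⊕ compl B) (c ↑ˡ r)))
  ... | no c≢c' = begin
    adjᶜ (A ∨G B) (c ↑ˡ r) (c' ↑ˡ r)     ≡⟨ adjᶜ≢ (A ∨G B) (λ e → c≢c' (↑ˡ-injective r c c' e)) ⟩
    not (adj (A ∨G B) (c ↑ˡ r) (c' ↑ˡ r)) ≡⟨ cong not (∨G-adj-ll A B c c') ⟩
    not (adj A c c')                      ≡⟨ sym (adjᶜ≢ A c≢c') ⟩
    adjᶜ A c c'                           ≡⟨ sym (⊕-adj-ll (compl A) (compl B) c c') ⟩
    adj (compl A ⊕ compl B) (c ↑ˡ r) (c' ↑ˡ r) ∎
  by-sides (inj₂ (y , refl)) (inj₂ (y' , refl)) with y ≟ y'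
  ... | yes refl = trans (adj-loopless (compl (A ∨G B)) (t ↑ʳ y)) (sym (adj-loopless (compl A ⊕ compl B) (t ↑ʳ y)))
  ... | no y≢y' = begin
    adjᶜ (A ∨G B) (t ↑ʳ y) (t ↑ʳ y')     ≡⟨ adjᶜ≢ (A ∨G B) (λ e → y≢y' (↑ʳ-injective t y y' e)) ⟩
    not (adj (A ∨G B) (t ↑ʳ y) (t ↑ʳ y')) ≡⟨ cong not (∨G-adj-rr A B y y') ⟩
    not (adj B y y')                      ≡⟨ sym (adjᶜ≢ B y≢y') ⟩
    adjᶜ B y y'                           ≡⟨ sym (⊕-adj-rr (compl A) (compl B) y y') ⟩
    adj (compl A ⊕ compl B) (t ↑ʳ y) (t ↑ʳ y') ∎
  by-sides (inj₁ (c , refl)) (inj₂ (y , refl)) =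
    trans (adjᶜ≢ (A ∨G B) (↑ˡ≢↑ʳ t r c y)) (trans (cong not (∨G-adj-lr A B c y)) (sym (⊕-adj-lr (compl A) (compl B) c y)))
  by-sides (inj₂ (y , refl)) (inj₁ (c , refl)) =
    trans (adjᶜ≢ (A ∨G B) (≢-sym (↑ˡ≢↑ʳ t r c y))) (trans (cong not (∨G-adj-rl A B y c)) (sym (⊕-adj-rl (compl A) (compl B) y c)))

-- Relations that are a closed core plus a perfect matching

AdjIso-from-injective : ∀ {m n} (a : Adjacency n) (b : Adjacency m) (h : Fin m → Fin n) → Inj h → m ≡ n →
                        (∀ i j → b i j ≡ a (h i) (h j)) → AdjIso a b
AdjIso-from-injective a b h h-inj m≡n b≗a∘h = iso , λ v w → sym (trans (b≗a∘h (h⁻ v) (h⁻ w)) (cong₂ a (h∘h⁻ v) (h∘h⁻ w)))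
  where
  onto = injective⇒surjective h h-inj m≡n
  h⁻ = λ v → proj₁ (onto v)
  h∘h⁻ = λ v → proj₂ (onto v)
  iso = mk↔ₛ′ h⁻ h (λ i → h-inj (h∘h⁻ (h i))) h∘h⁻

OffCore : ∀ {t n} → (Fin t → Fin n) → Fin n → Set
OffCore core v = ∀ j → v ≢ core j

off-core? : ∀ {t n} (core : Fin t → Fin n) v → (∃[ c ] v ≡ core c) ⊎ OffCore core v
off-core? core v with any? (λ c → v ≟ core c)
... | yes w = inj₁ w
... | no nw = inj₂ (λ j e → nw (j , e))

enumerate-off-core : ∀ t r {n} (core : Fin t → Fin n) → t + r ≡ n → Inj core →
                     Σ (Fin r → Fin n) λ ρ → Inj ρ × (∀ z → OffCore core (ρ z))
enumerate-off-core zero r core refl core-inj = (λ z → z) , (λ e → e) , λ z ()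
enumerate-off-core (suc t) r core refl core-inj with enumerate-off-core t r core′ refl core′-inj
  where
  c₀≢ : ∀ j → core zero ≢ core (suc j)
  c₀≢ j e = Fin-0≢1+n (core-inj e)
  core′ : Fin t → Fin (t + r)
  core′ j = punchOut (c₀≢ j)
  core′-inj : Inj core′
  core′-inj {i} {j} e = Fin-suc-injective (core-inj (punchOut-injective (c₀≢ i) (c₀≢ j) e))
... | ρ′ , ρ′-inj , ρ′-off = (λ z → punchIn (core zero) (ρ′ z)) , (λ e → ρ′-inj (punchIn-injective (core zero) _ _ e)) , ρ-off
  where
  ρ-off : ∀ z → OffCore core (punchIn (core zero) (ρ′ z))
  ρ-off z zero e = punchInᵢ≢i (core zero) (ρ′ z) e
  ρ-off z (suc j) e = ρ′-off z j (punchIn-injective (core zero) _ _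
                        (trans e (sym (punchIn-punchOut (λ e′ → Fin-0≢1+n (core-inj e′))))))

record CoreWithMatching {n} (a : Adjacency n) {t} (X : Adjacency t) (r : ℕ) : Set where
  field
    order : t + r ≡ n
    core : Fin t → Fin n
    core-injective : Inj core
    core-adj : ∀ i j → a (core i) (core j) ≡ X i j
    core-closed : ∀ i v → OffCore core v → a (core i) v ≡ false
    matched : ∀ v → OffCore core v → HasUniqueNeighbour a v

CoreWithMatching-≗ : ∀ {n} {a b : Adjacency n} {t} {X : Adjacency t} {r} → (∀ i j → a i j ≡ b i j) →
                     CoreWithMatching a X r → CoreWithMatching b X r
CoreWithMatching-≗ {a = a} {b} a≗b C = record
  { order = order ; core = core ; core-injective = core-injective
  ; core-adj = λ i j → trans (sym (a≗b (core i) (core j))) (core-adj i j)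
  ; core-closed = λ i v off → trans (sym (a≗b (core i) v)) (core-closed i v off)
  ; matched = λ v off → case matched v off of λ where
      (q , vq , unique) → q , trans (sym (a≗b v q)) vq , λ q′ vq′ → unique q′ (trans (a≗b v q′) vq′) }
  where open CoreWithMatching C

module WithCore {n} {a : Adjacency n} (sym-a : SymAdj a) (loopless : Loopless a) {t} {X : Adjacency t} {r}
                (C : CoreWithMatching a X r) where
  open CoreWithMatching C public

  enumeration = enumerate-off-core t r core order core-injective
  ρ : Fin r → Fin n
  ρ = proj₁ enumeration
  ρ-inj : Inj ρ
  ρ-inj = proj₁ (proj₂ enumeration)
  ρ-off : ∀ z → OffCore core (ρ z)
  ρ-off = proj₂ (proj₂ enumeration)

  -- Any injective enumeration k of the off-core vertices, put after the core, enumerates all vertices.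
  module Glued (k : Fin r → Fin n) (k-inj : Inj k) (k-off : ∀ z → OffCore core (k z)) where
    glue : Fin t ⊎ Fin r → Fin n
    glue (inj₁ c) = core c
    glue (inj₂ y) = k y
    glue-inj : ∀ {s s'} → glue s ≡ glue s' → s ≡ s'
    glue-inj {inj₁ c} {inj₁ c'} e = cong inj₁ (core-injective e)
    glue-inj {inj₁ c} {inj₂ y} e = ⊥-elim (k-off y c (sym e))
    glue-inj {inj₂ y} {inj₁ c} e = ⊥-elim (k-off y c e)
    glue-inj {inj₂ y} {inj₂ y'} e = cong inj₂ (k-inj e)
    h : Fin (t + r) → Fin n
    h i = glue (splitAt t i)
    h-inj : Inj h
    h-inj {i} {j} e = trans (sym (join-splitAt t r i)) (trans (cong (join t r) (glue-inj {splitAt t i} {splitAt t j} e)) (join-splitAt t r j))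
    h-↑ˡ : ∀ c → h (c ↑ˡ r) ≡ core c
    h-↑ˡ c = cong glue (splitAt-↑ˡ t c r)
    h-↑ʳ : ∀ y → h (t ↑ʳ y) ≡ k y
    h-↑ʳ y = cong glue (splitAt-↑ʳ t r y)

  ρ-onto : ∀ v → OffCore core v → ∃[ z ] ρ z ≡ v
  ρ-onto v off = from-preimage (injective⇒surjective h h-inj order v)
    where
    open Glued ρ ρ-inj ρ-off
    from-preimage : ∃[ i ] h i ≡ v → ∃[ z ] ρ z ≡ v
    from-preimage (i , hi) with ↑-view t r i
    ... | inj₁ (c , refl) = ⊥-elim (off c (trans (sym hi) (h-↑ˡ c)))
    ... | inj₂ (y , refl) = y , trans (sym (h-↑ʳ y)) hi

  partner-off-core : ∀ {v q} → OffCore core v → a v q ≡ true → OffCore core q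
  partner-off-core {v} {q} off vq j refl = true≢false (trans (sym vq) (trans (sym-a v (core j)) (core-closed j v off)))

  off-core-part : Adjacency r
  off-core-part x y = a (ρ x) (ρ y)

  off-core-part-matched : ∀ x → HasUniqueNeighbour off-core-part x
  off-core-part-matched x with matched (ρ x) (ρ-off x)
  ... | q , xq , unique with ρ-onto q (partner-off-core (ρ-off x) xq)
  ...   | z , refl = z , xq , λ z′ e′ → ρ-inj (unique (ρ z′) e′)

  ≅-core⊕ : (Xg : Graph t) → (∀ i j → adj Xg i j ≡ X i j) → (Y : Graph r) → AdjIso off-core-part (adj Y) →
             AdjIso a (adj (Xg ⊕ Y))
  ≅-core⊕ Xg Xg≗X Y (g , g-iso) = AdjIso-from-injective a (adj (Xg ⊕ Y)) h h-inj order pullback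
    where
    k : Fin r → Fin n
    k y = ρ (Inverse.from g y)
    k-inj : Inj k
    k-inj {y} {y'} e = trans (sym (Inverse.inverseˡ g refl)) (trans (cong (Inverse.to g) (ρ-inj e)) (Inverse.inverseˡ g refl))
    k-off : ∀ y → OffCore core (k y)
    k-off y = ρ-off (Inverse.from g y)
    open Glued k k-inj k-off
    by-sides : ∀ i j → (∃[ c ] i ≡ c ↑ˡ r) ⊎ (∃[ y ] i ≡ t ↑ʳ y) → (∃[ c ] j ≡ c ↑ˡ r) ⊎ (∃[ y ] j ≡ t ↑ʳ y) →
               adj (Xg ⊕ Y) i j ≡ a (h i) (h j)
    by-sides _ _ (inj₁ (c , refl)) (inj₁ (c' , refl)) =
      trans (⊕-adj-ll Xg Y c c') (trans (Xg≗X c c') (trans (sym (core-adj c c')) (sym (cong₂ a (h-↑ˡ c) (h-↑ˡ c')))))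
    by-sides _ _ (inj₁ (c , refl)) (inj₂ (y , refl)) =
      trans (⊕-adj-lr Xg Y c y) (sym (trans (cong₂ a (h-↑ˡ c) (h-↑ʳ y)) (core-closed c (k y) (k-off y))))
    by-sides _ _ (inj₂ (y , refl)) (inj₁ (c , refl)) =
      trans (⊕-adj-rl Xg Y y c) (sym (trans (cong₂ a (h-↑ʳ y) (h-↑ˡ c)) (trans (sym-a (k y) (core c)) (core-closed c (k y) (k-off y)))))
    by-sides _ _ (inj₂ (y , refl)) (inj₂ (y' , refl)) =
      trans (⊕-adj-rr Xg Y y y') (sym (trans (cong₂ a (h-↑ʳ y) (h-↑ʳ y'))
        (trans (g-iso (Inverse.from g y) (Inverse.from g y')) (cong₂ (adj Y) (Inverse.inverseˡ g refl) (Inverse.inverseˡ g refl)))))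
    pullback : ∀ i j → adj (Xg ⊕ Y) i j ≡ a (h i) (h j)
    pullback i j = by-sides i j (↑-view t r i) (↑-view t r j)

  degree-sum : sum (degree a) ≡ sum (degree X) + r
  degree-sum = begin
      sum (degree a)                                                   ≡⟨ sum-reindex (degree a) h h-inj order ⟩
      sum (λ i → degree a (h i))                                       ≡⟨ sum-++ t r (λ i → degree a (h i)) ⟩
      sum (λ c → degree a (h (c ↑ˡ r))) + sum (λ y → degree a (h (t ↑ʳ y)))
        ≡⟨ cong₂ _+_ (sum-cong-≗ (λ c → cong (degree a) (h-↑ˡ c))) (sum-cong-≗ (λ y → cong (degree a) (h-↑ʳ y))) ⟩
      sum (λ c → degree a (core c)) + sum (λ y → degree a (ρ y))
        ≡⟨ cong₂ _+_ (sum-cong-≗ core-degree) (trans (sum-cong-≗ (λ y → unique⇒degree≡1 a (matched (ρ y) (ρ-off y)))) (trans (sum-const {r} 1) (*-identityʳ r))) ⟩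
      sum (degree X) + r                                               ∎
    where
    open ≡-Reasoning
    open Glued ρ ρ-inj ρ-off
    core-degree : ∀ c → degree a (core c) ≡ degree X c
    core-degree c = begin
        count (a (core c))                                              ≡⟨ sum-reindex (λ v → bit (a (core c) v)) h h-inj order ⟩
        sum (λ i → bit (a (core c) (h i)))                              ≡⟨ sum-++ t r (λ i → bit (a (core c) (h i))) ⟩
        sum (λ c' → bit (a (core c) (h (c' ↑ˡ r)))) + sum (λ y → bit (a (core c) (h (t ↑ʳ y))))
          ≡⟨ cong₂ _+_ (sum-cong-≗ (λ c' → cong bit (trans (cong (a (core c)) (h-↑ˡ c')) (core-adj c c'))))
                       (sum-cong-≗ (λ y → cong bit (trans (cong (a (core c)) (h-↑ʳ y)) (core-closed c (ρ y) (ρ-off y))))) ⟩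
        count (X c) + sum {r} (λ _ → 0)                                 ≡⟨ cong (count (X c) +_) (trans (sum-const {r} 0) (*-zeroʳ r)) ⟩
        count (X c) + 0                                                 ≡⟨ +-identityʳ _ ⟩
        degree X c                                                      ∎

  private
    lift-dominated : ∀ {c c' k} → Dominates X c c' k → Dominates a (core c) (core c') (core k)
    lift-dominated {c} {c'} {k} (k≢c , k≢c' , ck∨c'k) =
      (λ e → k≢c (core-injective e)) , (λ e → k≢c' (core-injective e)) ,
      trans (cong₂ _∨_ (core-adj c k) (core-adj c' k)) ck∨c'k

    swap-dominated : ∀ {x y w} → Dominates a x y w → Dominates a y x w
    swap-dominated {x} {y} {w} (w≢x , w≢y , xw∨yw) = w≢y , w≢x , trans (∨-comm (a y w) (a x w)) xw∨yw

    partner : ∀ w → OffCore core w → ∃[ q ] a w q ≡ true × OffCore core q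
    partner w off with matched w off
    ... | q , wq , _ = q , wq , partner-off-core off wq

  -- A core vertex c and an off-core vertex w dominate w's partner and a core neighbour of c.
  core-and-off-core : (∀ c → ∃[ k ] X c k ≡ true) → ∀ {c w} → OffCore core w →
                      ∃[ w₁ ] ∃[ w₂ ] w₁ ≢ w₂ × Dominates a (core c) w w₁ × Dominates a (core c) w w₂
  core-and-off-core no-isolated {c} {w} off with partner w off | no-isolated c
  ... | q , wq , q-off | k , ck =
    q , core k , (λ e → q-off k e) ,
    ((λ e → q-off c e) , (λ e → neighbour-≢ a loopless wq (sym e)) , trans (cong (a (core c) q ∨_) wq) (∨-zeroʳ _)) ,
    ((λ e → k≢c (core-injective e)) , (λ e → off k (sym e)) , trans (cong (_∨ a w (core k)) (trans (core-adj c k) ck)) refl)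
    where
    k≢c : k ≢ c
    k≢c refl = true≢false (trans (sym ck) (trans (sym (core-adj c c)) (loopless (core c))))

  -- Two non-adjacent off-core vertices dominate their two (distinct) partners.
  off-core-pair : ∀ {u v} → u ≢ v → a u v ≡ false → OffCore core u → OffCore core v →
                  ∃[ w₁ ] ∃[ w₂ ] w₁ ≢ w₂ × Dominates a u v w₁ × Dominates a u v w₂
  off-core-pair {u} {v} u≢v uv off-u off-v with matched u off-u | matched v off-v
  ... | qu , uqu , _ | qv , vqv , _ =
    qu , qv , qu≢qv ,
    ((λ e → neighbour-≢ a loopless uqu (sym e)) , (λ e → true≢false (trans (sym uqu) (trans (cong (a u) e) uv))) ,
      trans (cong (_∨ a v qu) uqu) refl) ,
    ((λ e → true≢false (trans (sym vqv) (trans (cong (a v) e) (trans (sym-a v u) uv)))) , (λ e → neighbour-≢ a loopless vqv (sym e)) ,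
      trans (cong (a u qv ∨_) vqv) (∨-zeroʳ (a u qv)))
    where
    qu≢qv : qu ≢ qv
    qu≢qv refl with matched qu (partner-off-core off-u uqu)
    ... | _ , _ , unique = u≢v (trans (unique u (trans (sym-a qu u) uqu)) (sym (unique v (trans (sym-a qu v) vqv))))

  -- X only needs to be free of isolated vertices when there are matched vertices, i.e. when Fin r is inhabited.
  twiceDominating : TwiceDominating X → (Fin r → ∀ c → ∃[ k ] X c k ≡ true) → TwiceDominating a
  twiceDominating X-dominating no-isolated u v u≢v uv with off-core? core u | off-core? core v
  ... | inj₁ (c , refl) | inj₁ (c' , refl) with X-dominating c c' (λ e → u≢v (cong core e)) (trans (sym (core-adj c c')) uv)
  ...   | k₁ , k₂ , k₁≢k₂ , D₁ , D₂ = core k₁ , core k₂ , (λ e → k₁≢k₂ (core-injective e)) , lift-dominated D₁ , lift-dominated D₂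
  twiceDominating X-dominating no-isolated u v u≢v uv | inj₁ (c , refl) | inj₂ off =
    core-and-off-core (no-isolated (proj₁ (ρ-onto v off))) off
  twiceDominating X-dominating no-isolated u v u≢v uv | inj₂ off | inj₁ (c , refl)
    with core-and-off-core (no-isolated (proj₁ (ρ-onto u off))) {c} off
  ... | w₁ , w₂ , w₁≢w₂ , D₁ , D₂ = w₁ , w₂ , w₁≢w₂ , swap-dominated D₁ , swap-dominated D₂
  twiceDominating X-dominating no-isolated u v u≢v uv | inj₂ off-u | inj₂ off-v = off-core-pair u≢v uv off-u off-v

  off-core-part-sym : SymAdj off-core-part
  off-core-part-sym x y = sym-a (ρ x) (ρ y)

  off-core-part-loopless : Loopless off-core-part
  off-core-part-loopless x = loopless (ρ x)

matched-edge-core : ∀ {r} (a : Adjacency (2 + r)) → SymAdj a → Loopless a → (∀ v → HasUniqueNeighbour a v) →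
                    CoreWithMatching a (adj (K 2)) r
matched-edge-core a sym-a loopless matched = record
  { order = refl ; core = core ; core-injective = core-inj ; core-adj = core-adj ; core-closed = closed ; matched = λ v _ → matched v }
  where
  v₀ = zero
  w = proj₁ (matched v₀)
  v₀w = proj₁ (proj₂ (matched v₀))
  v₀≢w : v₀ ≢ w
  v₀≢w = neighbour-≢ a loopless v₀w
  core : Fin 2 → Fin _
  core zero = v₀
  core (suc zero) = w
  core-inj : Inj core
  core-inj {zero} {zero} e = refl
  core-inj {zero} {suc zero} e = ⊥-elim (v₀≢w e)
  core-inj {suc zero} {zero} e = ⊥-elim (v₀≢w (sym e))
  core-inj {suc zero} {suc zero} e = refl
  core-adj : ∀ i j → a (core i) (core j) ≡ adj (K 2) i j
  core-adj zero zero = loopless v₀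
  core-adj zero (suc zero) = v₀w
  core-adj (suc zero) zero = trans (sym-a w v₀) v₀w
  core-adj (suc zero) (suc zero) = loopless w
  closed : ∀ i v → OffCore core v → a (core i) v ≡ false
  closed zero v off with a v₀ v in v₀v
  ... | false = refl
  ... | true = ⊥-elim (off (suc zero) (proj₂ (proj₂ (matched v₀)) v v₀v))
  closed (suc zero) v off with a w v in wv
  ... | false = refl
  ... | true = ⊥-elim (off zero (trans (proj₂ (proj₂ (matched w)) v wv)
                                       (sym (proj₂ (proj₂ (matched w)) v₀ (trans (sym-a w v₀) v₀w)))))

matching-iso : ∀ k {n} (a : Adjacency n) → SymAdj a → Loopless a → (∀ v → HasUniqueNeighbour a v) → k * 2 ≡ n →
               AdjIso a (adj (copies k (K 2)))
matching-iso zero a _ _ _ refl = mk↔ₛ′ (λ ()) (λ ()) (λ ()) (λ ()) , λ ()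
matching-iso (suc k) a sym-a loopless matched refl =
  ≅-core⊕ (K 2) (λ _ _ → refl) (copies k (K 2))
    (matching-iso k off-core-part off-core-part-sym off-core-part-loopless off-core-part-matched refl)
  where open WithCore sym-a loopless (matched-edge-core a sym-a loopless matched)

core-with-matching⇒≅ : ∀ {n} {a : Adjacency n} {t} {X : Adjacency t} {r} → CoreWithMatching a X r → SymAdj a → Loopless a →
                       (Xg : Graph t) → (∀ i j → adj Xg i j ≡ X i j) → ∀ k → k * 2 ≡ r → AdjIso a (adj (Xg ⊕ copies k (K 2)))
core-with-matching⇒≅ C sym-a loopless Xg Xg≗X k refl =
  ≅-core⊕ Xg Xg≗X (copies k (K 2)) (matching-iso k off-core-part off-core-part-sym off-core-part-loopless off-core-part-matched refl)
  where open WithCore sym-a loopless C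

copies-matched : ∀ k (y : Fin (k * 2)) → HasUniqueNeighbour (adj (copies k (K 2))) y
copies-matched (suc k) y = by-side (↑-view 2 (k * 2) y)
  where
  Y = copies k (K 2)
  by-side : (∃[ c ] y ≡ c ↑ˡ (k * 2)) ⊎ (∃[ z ] y ≡ 2 ↑ʳ z) → HasUniqueNeighbour (adj (K 2 ⊕ Y)) y
  by-side (inj₁ (zero , refl)) = suc zero , refl , unique
    where
    unique : ∀ q' → adj (K 2 ⊕ Y) zero q' ≡ true → q' ≡ suc zero
    unique (suc zero) _ = refl
    unique (suc (suc q)) e = ⊥-elim (true≢false (trans (sym e) (⊕-adj-lr (K 2) Y zero q)))
  by-side (inj₁ (suc zero , refl)) = zero , refl , unique
    where
    unique : ∀ q' → adj (K 2 ⊕ Y) (suc zero) q' ≡ true → q' ≡ zero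
    unique zero _ = refl
    unique (suc (suc q)) e = ⊥-elim (true≢false (trans (sym e) (⊕-adj-lr (K 2) Y (suc zero) q)))
  by-side (inj₂ (z , refl)) with copies-matched k z
  ... | q , zq , unique = suc (suc q) , trans (⊕-adj-rr (K 2) Y z q) zq , unique′
    where
    unique′ : ∀ q' → adj (K 2 ⊕ Y) (suc (suc z)) q' ≡ true → q' ≡ suc (suc q)
    unique′ zero e = ⊥-elim (true≢false (trans (sym e) (⊕-adj-rl (K 2) Y z zero)))
    unique′ (suc zero) e = ⊥-elim (true≢false (trans (sym e) (⊕-adj-rl (K 2) Y z (suc zero))))
    unique′ (suc (suc q')) e = cong (λ x → suc (suc x)) (unique q' (trans (sym (⊕-adj-rr (K 2) Y z q')) e))

⊕-matching-core : ∀ {t} (Xg : Graph t) k → CoreWithMatching (adj (Xg ⊕ copies k (K 2))) (adj Xg) (k * 2)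
⊕-matching-core {t} Xg k = record
  { order = refl ; core = _↑ˡ r ; core-injective = ↑ˡ-injective r _ _
  ; core-adj = ⊕-adj-ll Xg Y ; core-closed = closed ; matched = matched }
  where
  r = k * 2
  Y = copies k (K 2)
  closed : ∀ i v → OffCore (_↑ˡ r) v → adj (Xg ⊕ Y) (i ↑ˡ r) v ≡ false
  closed i v off with ↑-view t r v
  ... | inj₁ (c , e) = ⊥-elim (off c e)
  ... | inj₂ (y , refl) = ⊕-adj-lr Xg Y i y
  matched : ∀ v → OffCore (_↑ˡ r) v → HasUniqueNeighbour (adj (Xg ⊕ Y)) v
  matched v off with ↑-view t r v
  ... | inj₁ (c , e) = ⊥-elim (off c e)
  ... | inj₂ (y , refl) with copies-matched k y
  ...   | q , yq , unique = t ↑ʳ q , trans (⊕-adj-rr Xg Y y q) yq , unique′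
    where
    unique′ : ∀ q' → adj (Xg ⊕ Y) (t ↑ʳ y) q' ≡ true → q' ≡ t ↑ʳ q
    unique′ q' e with ↑-view t r q'
    ... | inj₁ (c , refl) = ⊥-elim (true≢false (trans (sym e) (⊕-adj-rl Xg Y y c)))
    ... | inj₂ (y' , refl) = cong (t ↑ʳ_) (unique y' (trans (sym (⊕-adj-rr Xg Y y y')) e))

dominates? : ∀ {n} (a : Adjacency n) u v w → Dec (Dominates a u v w)
dominates? a u v w = ¬? (w ≟ u) ×-dec (¬? (w ≟ v) ×-dec ((a u w ∨ a v w) ≟ᵇ true))

twiceDominating? : ∀ {n} (a : Adjacency n) → Dec (TwiceDominating a)
twiceDominating? a = all? λ u → all? λ v → ¬? (u ≟ v) →-dec ((a u v ≟ᵇ false) →-dec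
  any? λ w₁ → any? λ w₂ → ¬? (w₁ ≟ w₂) ×-dec (dominates? a u v w₁ ×-dec dominates? a u v w₂))

no-isolated? : ∀ {t} (X : Adjacency t) → Dec (∀ c → ∃[ k ] X c k ≡ true)
no-isolated? X = all? λ c → any? λ k → X c k ≟ᵇ true

≗? : ∀ {t} (X Y : Adjacency t) → Dec (∀ i j → X i j ≡ Y i j)
≗? X Y = all? λ i → all? λ j → X i j ≟ᵇ Y i j

-- The extremal shapes are cores plus perfect matchings

core-adj-by-≤ : ∀ {t n} (a : Adjacency n) → SymAdj a → (X : Graph t) (core : Fin t → Fin n) →
                (∀ i j → toℕ i ≤ toℕ j → a (core i) (core j) ≡ adj X i j) → ∀ i j → a (core i) (core j) ≡ adj X i j
core-adj-by-≤ a sym-a X core upper i j with ≤-total (toℕ i) (toℕ j)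
... | inj₁ i≤j = upper i j i≤j
... | inj₂ j≤i = trans (sym-a (core i) (core j)) (trans (upper j i j≤i) (adj-sym X j i))

module ShapeCores {n} (a : Adjacency n) (sym-a : SymAdj a) (loopless : Loopless a) where

  triangle-core : TriangleShape a → ∀ r → 3 + r ≡ n → CoreWithMatching a (adj (K 3)) r
  triangle-core T r order = record
    { order = order ; core = core ; core-injective = injective-by-< core distinct
    ; core-adj = core-adj-by-≤ a sym-a (K 3) core upper ; core-closed = closed
    ; matched = λ v off → degree≡1⇒unique a (positive v) (others v (off zero) (off (suc zero)) (off (suc (suc zero)))) }
    where
    open TriangleShape T
    core : Fin 3 → Fin n
    core zero = x
    core (suc zero) = y
    core (suc (suc zero)) = z
    distinct : ∀ i j → toℕ i < toℕ j → core i ≢ core j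
    distinct zero (suc zero) _ = x≢y
    distinct zero (suc (suc zero)) _ = x≢z
    distinct (suc zero) (suc (suc zero)) _ = y≢z
    distinct _ zero ()
    distinct (suc _) (suc zero) (s≤s ())
    distinct (suc (suc _)) (suc (suc zero)) (s≤s (s≤s ()))
    upper : ∀ i j → toℕ i ≤ toℕ j → a (core i) (core j) ≡ adj (K 3) i j
    upper zero zero _ = loopless x
    upper zero (suc zero) _ = xy
    upper zero (suc (suc zero)) _ = xz
    upper (suc zero) (suc zero) _ = loopless y
    upper (suc zero) (suc (suc zero)) _ = yz
    upper (suc (suc zero)) (suc (suc zero)) _ = loopless z
    upper (suc _) zero ()
    upper (suc (suc _)) (suc zero) (s≤s ())
    closed : ∀ i v → OffCore core v → a (core i) v ≡ false
    closed zero v off = non-neighbour₂ a dx xy xz y≢z (off (suc zero)) (off (suc (suc zero)))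
    closed (suc zero) v off = non-neighbour₂ a dy (trans (sym-a y x) xy) yz x≢z (off zero) (off (suc (suc zero)))
    closed (suc (suc zero)) v off = non-neighbour₂ a dz (trans (sym-a z x) xz) (trans (sym-a z y) yz) x≢y (off zero) (off (suc zero))

  path-core : P₅Shape a → ∀ r → 5 + r ≡ n → CoreWithMatching a (adj (P 5)) r
  path-core S r order = record
    { order = order ; core = core ; core-injective = injective-by-< core distinct
    ; core-adj = core-adj-by-≤ a sym-a (P 5) core upper ; core-closed = closed
    ; matched = λ v off → degree≡1⇒unique a (positive v) (others v (off (suc zero)) (off (suc (suc zero))) (off (suc (suc (suc zero))))) }
    where
    open P₅Shape S
    dl₁ : degree a l₁ ≤ 1
    dl₁ = others l₁ l₁≢x l₁≢y l₁≢z
    dl₂ : degree a l₂ ≤ 1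
    dl₂ = others l₂ (≢-sym x≢l₂) (≢-sym y≢l₂) (≢-sym z≢l₂)
    xl₁ = trans (sym-a x l₁) l₁x
    yx = trans (sym-a y x) xy
    zy = trans (sym-a z y) yz
    l₂z = trans (sym-a l₂ z) zl₂
    core : Fin 5 → Fin n
    core zero = l₁
    core (suc zero) = x
    core (suc (suc zero)) = y
    core (suc (suc (suc zero))) = z
    core (suc (suc (suc (suc zero)))) = l₂
    distinct : ∀ i j → toℕ i < toℕ j → core i ≢ core j
    distinct zero (suc zero) _ = l₁≢x
    distinct zero (suc (suc zero)) _ = l₁≢y
    distinct zero (suc (suc (suc zero))) _ = l₁≢z
    distinct zero (suc (suc (suc (suc zero)))) _ = l₁≢l₂
    distinct (suc zero) (suc (suc zero)) _ = x≢y
    distinct (suc zero) (suc (suc (suc zero))) _ = x≢z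
    distinct (suc zero) (suc (suc (suc (suc zero)))) _ = x≢l₂
    distinct (suc (suc zero)) (suc (suc (suc zero))) _ = y≢z
    distinct (suc (suc zero)) (suc (suc (suc (suc zero)))) _ = y≢l₂
    distinct (suc (suc (suc zero))) (suc (suc (suc (suc zero)))) _ = z≢l₂
    distinct _ zero ()
    distinct (suc _) (suc zero) (s≤s ())
    distinct (suc (suc _)) (suc (suc zero)) (s≤s (s≤s ()))
    distinct (suc (suc (suc _))) (suc (suc (suc zero))) (s≤s (s≤s (s≤s ())))
    distinct (suc (suc (suc (suc _)))) (suc (suc (suc (suc zero)))) (s≤s (s≤s (s≤s (s≤s ()))))
    upper : ∀ i j → toℕ i ≤ toℕ j → a (core i) (core j) ≡ adj (P 5) i j
    upper zero zero _ = loopless l₁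
    upper zero (suc zero) _ = l₁x
    upper zero (suc (suc zero)) _ = non-neighbour₁ a dl₁ l₁x (≢-sym x≢y)
    upper zero (suc (suc (suc zero))) _ = non-neighbour₁ a dl₁ l₁x (≢-sym x≢z)
    upper zero (suc (suc (suc (suc zero)))) _ = non-neighbour₁ a dl₁ l₁x (≢-sym x≢l₂)
    upper (suc zero) (suc zero) _ = loopless x
    upper (suc zero) (suc (suc zero)) _ = xy
    upper (suc zero) (suc (suc (suc zero))) _ = non-neighbour₂ a dx xl₁ xy l₁≢y (≢-sym l₁≢z) (≢-sym y≢z)
    upper (suc zero) (suc (suc (suc (suc zero)))) _ = non-neighbour₂ a dx xl₁ xy l₁≢y (≢-sym l₁≢l₂) (≢-sym y≢l₂)
    upper (suc (suc zero)) (suc (suc zero)) _ = loopless y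
    upper (suc (suc zero)) (suc (suc (suc zero))) _ = yz
    upper (suc (suc zero)) (suc (suc (suc (suc zero)))) _ = non-neighbour₂ a dy yx yz x≢z (≢-sym x≢l₂) (≢-sym z≢l₂)
    upper (suc (suc (suc zero))) (suc (suc (suc zero))) _ = loopless z
    upper (suc (suc (suc zero))) (suc (suc (suc (suc zero)))) _ = zl₂
    upper (suc (suc (suc (suc zero)))) (suc (suc (suc (suc zero)))) _ = loopless l₂
    upper (suc _) zero ()
    upper (suc (suc _)) (suc zero) (s≤s ())
    upper (suc (suc (suc _))) (suc (suc zero)) (s≤s (s≤s ()))
    upper (suc (suc (suc (suc _)))) (suc (suc (suc zero))) (s≤s (s≤s (s≤s ())))
    closed : ∀ i v → OffCore core v → a (core i) v ≡ false
    closed zero v off = non-neighbour₁ a dl₁ l₁x (off (suc zero))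
    closed (suc zero) v off = non-neighbour₂ a dx xl₁ xy l₁≢y (off zero) (off (suc (suc zero)))
    closed (suc (suc zero)) v off = non-neighbour₂ a dy yx yz x≢z (off (suc zero)) (off (suc (suc (suc zero))))
    closed (suc (suc (suc zero))) v off = non-neighbour₂ a dz zy zl₂ y≢l₂ (off (suc (suc zero))) (off (suc (suc (suc (suc zero)))))
    closed (suc (suc (suc (suc zero)))) v off = non-neighbour₁ a dl₂ l₂z (off (suc (suc (suc zero))))

  matching-core : (∀ v → HasUniqueNeighbour a v) → ∀ r → r ≡ n → CoreWithMatching a (adj (emptyG 0)) r
  matching-core matched r order = record
    { order = order ; core = λ () ; core-injective = λ {i} → ⊥-elim (Fin0 i) ; core-adj = λ ()
    ; core-closed = λ () ; matched = λ v _ → matched v }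
    where
    Fin0 : Fin 0 → ⊥
    Fin0 ()

-- On five vertices an isolated vertex u forces the other four to have degree exactly 2, i.e. to form a 4-cycle.
module IsolatedVertexCase (a : Adjacency 5) (sym-a : SymAdj a) (loopless : Loopless a) (dominating : TwiceDominating a)
                          (u : Fin 5) (du : degree a u ≡ 0) (∑d≡ : sum (degree a) ≡ 8) where
  open Domination a sym-a loopless dominating

  u-isolated : ∀ w → a u w ≡ false
  u-isolated w with a u w in uw
  ... | false = refl
  ... | true = ⊥-elim (1+n≰n (≤-trans (count≥1 (a u) uw) (≤-reflexive du)))

  degree≤2 : ∀ w → w ≢ u → d w ≤ 2
  degree≤2 w w≢u with punchIn-cover (≢-sym w≢u)
  ... | w′ , refl = +-cancelʳ-≤ 6 (d w) 2 (≤-trans (+-monoʳ-≤ (d w) others≥6) (≤-reflexive (trans (sym split₂) (trans (sym split₁) ∑d≡))))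
    where
    others : Fin 3 → ℕ
    others x = d (punchIn u (punchIn w′ x))
    others≥6 : 6 ≤ sum others
    others≥6 = double-length≤sum others (λ x → isolated⇒degree≥2 du (punchIn u (punchIn w′ x)) (punchInᵢ≢i u _))
    split₁ : sum d ≡ sum (λ x → d (punchIn u x))
    split₁ = trans (sum-remove {i = u} d) (cong (_+ sum (λ x → d (punchIn u x))) du)
    split₂ : sum (λ x → d (punchIn u x)) ≡ d w + sum others
    split₂ = sum-remove {i = w′} (λ x → d (punchIn u x))

  module Cycle {v x y z : Fin 5} (v≢u : v ≢ u) (vx : a v x ≡ true) (vy : a v y ≡ true) (x≢y : x ≢ y)
               (x≢u : x ≢ u) (y≢u : y ≢ u) (u≢z : u ≢ z) (v≢z : v ≢ z) (x≢z : x ≢ z) (y≢z : y ≢ z) where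
    v≢x = neighbour-≢′ vx
    v≢y = neighbour-≢′ vy

    core : Fin 5 → Fin 5
    core zero = u
    core (suc zero) = v
    core (suc (suc zero)) = z
    core (suc (suc (suc zero))) = x
    core (suc (suc (suc (suc zero)))) = y
    distinct : ∀ i j → toℕ i < toℕ j → core i ≢ core j
    distinct zero (suc zero) _ = ≢-sym v≢u
    distinct zero (suc (suc zero)) _ = u≢z
    distinct zero (suc (suc (suc zero))) _ = ≢-sym x≢u
    distinct zero (suc (suc (suc (suc zero)))) _ = ≢-sym y≢u
    distinct (suc zero) (suc (suc zero)) _ = v≢z
    distinct (suc zero) (suc (suc (suc zero))) _ = v≢x
    distinct (suc zero) (suc (suc (suc (suc zero)))) _ = v≢y
    distinct (suc (suc zero)) (suc (suc (suc zero))) _ = ≢-sym x≢z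
    distinct (suc (suc zero)) (suc (suc (suc (suc zero)))) _ = ≢-sym y≢z
    distinct (suc (suc (suc zero))) (suc (suc (suc (suc zero)))) _ = x≢y
    distinct _ zero ()
    distinct (suc _) (suc zero) (s≤s ())
    distinct (suc (suc _)) (suc (suc zero)) (s≤s (s≤s ()))
    distinct (suc (suc (suc _))) (suc (suc (suc zero))) (s≤s (s≤s (s≤s ())))
    distinct (suc (suc (suc (suc _)))) (suc (suc (suc (suc zero)))) (s≤s (s≤s (s≤s (s≤s ()))))
    core-inj : Inj core
    core-inj = injective-by-< core distinct
    onto : ∀ w → ∃[ i ] core i ≡ w
    onto = injective⇒surjective core core-inj refl

    vz : a v z ≡ false
    vz = non-neighbour₂ a (degree≤2 v v≢u) vx vy x≢y (≢-sym x≢z) (≢-sym y≢z)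

    neighbour-of-z : ∀ w → a z w ≡ true → w ≡ x ⊎ w ≡ y
    neighbour-of-z w zw with onto w
    ... | zero , refl = ⊥-elim (true≢false (trans (sym zw) (trans (sym-a z u) (u-isolated z))))
    ... | suc zero , refl = ⊥-elim (true≢false (trans (sym zw) (trans (sym-a z v) vz)))
    ... | suc (suc zero) , refl = ⊥-elim (neighbour-≢′ zw refl)
    ... | suc (suc (suc zero)) , refl = inj₁ refl
    ... | suc (suc (suc (suc zero))) , refl = inj₂ refl

    z-neighbours : a z x ≡ true × a z y ≡ true
    z-neighbours with count-witnesses₂ (a z) (isolated⇒degree≥2 du z (≢-sym u≢z))
    ... | q₁ , q₂ , q₁≢q₂ , zq₁ , zq₂ with neighbour-of-z q₁ zq₁ | neighbour-of-z q₂ zq₂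
    ...   | inj₁ refl | inj₁ refl = ⊥-elim (q₁≢q₂ refl)
    ...   | inj₁ refl | inj₂ refl = zq₁ , zq₂
    ...   | inj₂ refl | inj₁ refl = zq₂ , zq₁
    ...   | inj₂ refl | inj₂ refl = ⊥-elim (q₁≢q₂ refl)

    zx = proj₁ z-neighbours
    zy = proj₂ z-neighbours
    xy : a x y ≡ false
    xy = non-neighbour₂ a (degree≤2 x x≢u) (trans (sym-a x v) vx) (trans (sym-a x z) zx) v≢z (≢-sym v≢y) y≢z

    upper : ∀ i j → toℕ i ≤ toℕ j → a (core i) (core j) ≡ adjᶜ (K 1 ∨G copies 2 (P 2)) i j
    upper zero zero _ = loopless u
    upper zero (suc zero) _ = u-isolated v
    upper zero (suc (suc zero)) _ = u-isolated z
    upper zero (suc (suc (suc zero))) _ = u-isolated x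
    upper zero (suc (suc (suc (suc zero)))) _ = u-isolated y
    upper (suc zero) (suc zero) _ = loopless v
    upper (suc zero) (suc (suc zero)) _ = vz
    upper (suc zero) (suc (suc (suc zero))) _ = vx
    upper (suc zero) (suc (suc (suc (suc zero)))) _ = vy
    upper (suc (suc zero)) (suc (suc zero)) _ = loopless z
    upper (suc (suc zero)) (suc (suc (suc zero))) _ = zx
    upper (suc (suc zero)) (suc (suc (suc (suc zero)))) _ = zy
    upper (suc (suc (suc zero))) (suc (suc (suc zero))) _ = loopless x
    upper (suc (suc (suc zero))) (suc (suc (suc (suc zero)))) _ = xy
    upper (suc (suc (suc (suc zero)))) (suc (suc (suc (suc zero)))) _ = loopless y
    upper (suc _) zero ()
    upper (suc (suc _)) (suc zero) (s≤s ())
    upper (suc (suc (suc _))) (suc (suc zero)) (s≤s (s≤s ()))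
    upper (suc (suc (suc (suc _)))) (suc (suc (suc zero))) (s≤s (s≤s (s≤s ())))

    cycle-core : CoreWithMatching a (adjᶜ (K 1 ∨G copies 2 (P 2))) 0
    cycle-core = record
      { order = refl ; core = core ; core-injective = core-inj
      ; core-adj = core-adj-by-≤ a sym-a (compl (K 1 ∨G copies 2 (P 2))) core upper
      ; core-closed = λ i w off → ⊥-elim (off (proj₁ (onto w)) (sym (proj₂ (onto w))))
      ; matched = λ w off → ⊥-elim (off (proj₁ (onto w)) (sym (proj₂ (onto w)))) }

  cycle-core : CoreWithMatching a (adjᶜ (K 1 ∨G copies 2 (P 2))) 0
  cycle-core = from-neighbours (count-witnesses₂ (a v) (isolated⇒degree≥2 du v v≢u))
    where
    v = punchIn u zero
    v≢u : v ≢ u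
    v≢u = punchInᵢ≢i u zero
    from-neighbours : ∃[ x ] ∃[ y ] x ≢ y × a v x ≡ true × a v y ≡ true → CoreWithMatching a (adjᶜ (K 1 ∨G copies 2 (P 2))) 0
    from-neighbours (x , y , x≢y , vx , vy) = Cycle.cycle-core v≢u vx vy x≢y x≢u y≢u (avoids zero) (avoids (suc zero))
                                                                 (avoids (suc (suc zero))) (avoids (suc (suc (suc zero))))
      where
      not-u : ∀ {w} → a v w ≡ true → w ≢ u
      not-u vw refl = true≢false (trans (sym vw) (trans (sym-a v u) (u-isolated v)))
      x≢u = not-u vx
      y≢u = not-u vy
      four : Fin 4 → Fin 5
      four zero = u
      four (suc zero) = v
      four (suc (suc zero)) = x
      four (suc (suc (suc zero))) = y
      distinct : ∀ i j → toℕ i < toℕ j → four i ≢ four j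
      distinct zero (suc zero) _ = ≢-sym v≢u
      distinct zero (suc (suc zero)) _ = ≢-sym x≢u
      distinct zero (suc (suc (suc zero))) _ = ≢-sym y≢u
      distinct (suc zero) (suc (suc zero)) _ = neighbour-≢′ vx
      distinct (suc zero) (suc (suc (suc zero))) _ = neighbour-≢′ vy
      distinct (suc (suc zero)) (suc (suc (suc zero))) _ = x≢y
      distinct _ zero ()
      distinct (suc _) (suc zero) (s≤s ())
      distinct (suc (suc _)) (suc (suc zero)) (s≤s (s≤s ()))
      distinct (suc (suc (suc _))) (suc (suc (suc zero))) (s≤s (s≤s (s≤s ())))
      fifth = fresh four (injective-by-< four distinct) (s≤s (s≤s (s≤s (s≤s (s≤s z≤n)))))
      avoids = proj₂ fifth

-- Extremal graphs are those with fewest missing edges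

isEx⇔size≡ : ∀ {N N' k} (B : Graph k) (C : Graph N') → N' ≡ N → ¬ (B ⊆ C) → (∀ (G' : Graph N) → ¬ (B ⊆ G') → size G' ≤ size C) →
             ∀ (G : Graph N) → ¬ (B ⊆ G) → IsEx N B (size G) ⇔ size G ≡ size C
isEx⇔size≡ B C refl C-free maximal G G-free =
  mk⇔ (λ (_ , G-max) → ≤-antisym (maximal G G-free) (G-max C C-free))
      (λ G≡C → (G , G-free , refl) , λ G' G'-free → subst (size G' ≤_) (sym G≡C) (maximal G' G'-free))

compl-size-≤⇒size-≥ : ∀ {N N'} (G : Graph N) (C : Graph N') → N ≡ N' → size (compl C) ≤ size (compl G) → size G ≤ size C
compl-size-≤⇒size-≥ G C refl le =
  +-cancelʳ-≤ (size (compl C)) (size G) (size C)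
    (≤-trans (+-monoʳ-≤ (size G) le) (≤-reflexive (trans (size+size-compl G) (sym (size+size-compl C)))))

size≡⇒compl-size≡ : ∀ {N N'} (G : Graph N) (C : Graph N') → N ≡ N' → size G ≡ size C → size (compl G) ≡ size (compl C)
size≡⇒compl-size≡ G C refl e = +-cancelˡ-≡ (size G) _ _ (trans (size+size-compl G) (trans (sym (size+size-compl C)) (cong (_+ size (compl C)) (sym e))))

compl-size-from-degrees : ∀ {n} (G : Graph n) e → sum (degree (adjᶜ G)) ≡ e + e → size (compl G) ≡ e
compl-size-from-degrees G e ∑d≡ = +-self-injective (trans (sym (handshake-graph (compl G))) ∑d≡)

compl-size-≥-from-degrees : ∀ {n} (G : Graph n) e → e + e ≤ sum (degree (adjᶜ G)) → e ≤ size (compl G)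
compl-size-≥-from-degrees G e le with e ≤? size (compl G)
... | yes e≤ = e≤
... | no e≰ = ⊥-elim (<-irrefl refl (≤-trans (+-mono-< (≰⇒> e≰) (≰⇒> e≰)) (≤-trans le (≤-reflexive (handshake-graph (compl G))))))

≅-from-core : ∀ {n t} (G : Graph n) (Xg : Graph t) k (C : Graph (t + k * 2)) → (∀ i j → adj (Xg ⊕ copies k (K 2)) i j ≡ adjᶜ C i j) →
              CoreWithMatching (adjᶜ G) (adj Xg) (k * 2) → G ≅ C
≅-from-core G Xg k C T≗ core =
  ≅-from-complements G C (Xg ⊕ copies k (K 2))
    (core-with-matching⇒≅ core (adj-sym (compl G)) (adj-loopless (compl G)) Xg (λ _ _ → refl) k refl) T≗

compl-join-≗ : ∀ {t r} (A Xg : Graph t) (Y : Graph r) → (∀ i j → adjᶜ A i j ≡ adj Xg i j) →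
               ∀ i j → adj (Xg ⊕ Y) i j ≡ adjᶜ (A ∨G compl Y) i j
compl-join-≗ A Xg Y A≗ i j = sym (trans (compl-∨G A (compl Y) i j) (⊕-cong (compl A) Xg (compl (compl Y)) Y A≗ (compl-compl Y) i j))

module Target {t} (Xg : Graph t) (k : ℕ) (C : Graph (t + k * 2)) (T≗ : ∀ i j → adj (Xg ⊕ copies k (K 2)) i j ≡ adjᶜ C i j) where

  core : CoreWithMatching (adjᶜ C) (adj Xg) (k * 2)
  core = CoreWithMatching-≗ T≗ (⊕-matching-core Xg k)

  book-free : ∀ p → t + k * 2 ≡ 3 + p → TwiceDominating (adj Xg) → (Fin (k * 2) → ∀ c → ∃[ j ] adj Xg c j ≡ true) → ¬ (Book p ⊆ C)
  book-free p order Xg-dominating no-isolated =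
    twiceDominating⇒book-free p order C (WithCore.twiceDominating (adj-sym (compl C)) (adj-loopless (compl C)) core Xg-dominating no-isolated)

  compl-size : ∀ e → sum (degree (adj Xg)) + k * 2 ≡ e + e → size (compl C) ≡ e
  compl-size e ∑≡ = compl-size-from-degrees C e (trans (WithCore.degree-sum (adj-sym (compl C)) (adj-loopless (compl C)) core) ∑≡)

compl-size≡⇒size≡ : ∀ {N N'} (G : Graph N) (C : Graph N') → N ≡ N' → size (compl G) ≡ size (compl C) → size G ≡ size C
compl-size≡⇒size≡ G C refl e = +-cancelʳ-≡ (size (compl C)) _ _ (trans (cong (size G +_) (sym e)) (trans (size+size-compl G) (sym (size+size-compl C))))

extremal-characterisation : ∀ {N N' k} (B : Graph k) (C : Graph N') → N' ≡ N → ¬ (B ⊆ C) →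
  (∀ (G' : Graph N) → ¬ (B ⊆ G') → size (compl C) ≤ size (compl G')) → (P : Graph N → Set) →
  (∀ G → ¬ (B ⊆ G) → size (compl G) ≡ size (compl C) → P G) → (∀ G → P G → size G ≡ size C) →
  ∀ (G : Graph N) → ¬ (B ⊆ G) → IsEx N B (size G) ⇔ P G
extremal-characterisation B C N'≡N C-free fewest-missing P classify P⇒size G G-free =
  mk⇔ (λ ex → classify G G-free (size≡⇒compl-size≡ G C (sym N'≡N) (Equivalence.to extremal ex)))
      (λ PG → Equivalence.from extremal (P⇒size G PG))
  where
  maximal : ∀ G' → ¬ (B ⊆ G') → size G' ≤ size C
  maximal G' G'-free = compl-size-≤⇒size-≥ G' C (sym N'≡N) (fewest-missing G' G'-free)
  extremal = isEx⇔size≡ B C N'≡N C-free maximal G G-free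

-- Odd p: the complement of a perfect matching

module OddCase (k : ℕ) where
  p e₀ : ℕ
  p = suc (k * 2)
  e₀ = suc (suc k)
  Y C : Graph (e₀ * 2)
  Y = copies e₀ (K 2)
  C = KminusPM e₀

  order : p + 3 ≡ 3 + p
  order = +-comm p 3
  C-order : e₀ * 2 ≡ p + 3
  C-order = ar k
    where
    ar : ∀ k → suc (suc k) * 2 ≡ suc (k * 2) + 3
    ar = solve-∀
  double-e₀ : e₀ + e₀ ≡ 3 + p
  double-e₀ = ar k
    where
    ar : ∀ k → suc (suc k) + suc (suc k) ≡ 3 + suc (k * 2)
    ar = solve-∀

  open Target (emptyG 0) e₀ C (λ i j → sym (compl-compl Y i j))

  C-free : ¬ (Book p ⊆ C)
  C-free = book-free p (trans C-order order) (λ ()) (λ _ ())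

  compl-C : size (compl C) ≡ e₀
  compl-C = compl-size e₀ (ar k)
    where
    ar : ∀ k → suc (suc k) * 2 ≡ suc (suc k) + suc (suc k)
    ar = solve-∀

  module Missing (G : Graph (p + 3)) (G-free : ¬ (Book p ⊆ G)) where
    dominating = book-free⇒twiceDominating p order G G-free
    sym-G = adj-sym (compl G)
    loopless-G = adj-loopless (compl G)

    fewest-missing : size (compl C) ≤ size (compl G)
    fewest-missing = subst (_≤ size (compl G)) (sym compl-C)
      (compl-size-≥-from-degrees G e₀ (≤-trans (≤-reflexive double-e₀) (order≤degree-sum p order (adjᶜ G) sym-G loopless-G dominating)))

    classify : size (compl G) ≡ size (compl C) → G ≅ C
    classify e = ≅-from-core G (emptyG 0) e₀ C (λ i j → sym (compl-compl Y i j))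
      (ShapeCores.matching-core (adjᶜ G) sym-G loopless-G matched (e₀ * 2) C-order)
      where
      matched = degree-sum≡order⇒matching p order (adjᶜ G) sym-G loopless-G dominating
                  (trans (handshake-graph (compl G)) (trans (cong₂ _+_ (trans e compl-C) (trans e compl-C)) double-e₀))

  result : ∀ (G : Graph (p + 3)) → ¬ (Book p ⊆ G) → IsEx (p + 3) (Book p) (size G) ⇔ G ≅ C
  result = extremal-characterisation (Book p) C C-order C-free (λ G' free → Missing.fewest-missing G' free) (λ G → G ≅ C)
             (λ G free → Missing.classify G free) (λ G G≅C → size-≅ G C G≅C)

-- Even p ≥ 4: a triangle or a path P₅ plus a perfect matching in the complement

module EvenCase (k : ℕ) where
  p e₀ m : ℕ
  p = suc (suc k) * 2
  e₀ = 5 + k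
  m = suc (suc (k * 2))
  Y₁ : Graph (suc (suc k) * 2)
  Y₁ = copies (suc (suc k)) (K 2)
  Y₂ : Graph (suc k * 2)
  Y₂ = copies (suc k) (K 2)
  C₁ : Graph (3 + suc (suc k) * 2)
  C₁ = emptyG 3 ∨G KminusPM (suc (suc k))
  C₂ : Graph (5 + suc k * 2)
  C₂ = compl (P 5) ∨G KminusPM (suc k)

  order : p + 3 ≡ 3 + p
  order = +-comm p 3
  order₅ : p + 3 ≡ 5 + m
  order₅ = ar k
    where
    ar : ∀ k → suc (suc k) * 2 + 3 ≡ 5 + suc (suc (k * 2))
    ar = solve-∀
  odd : 5 + m ≡ suc ((3 + k) + (3 + k))
  odd = ar k
    where
    ar : ∀ k → 5 + suc (suc (k * 2)) ≡ suc ((3 + k) + (3 + k))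
    ar = solve-∀
  double-e₀ : e₀ + e₀ ≡ 8 + m
  double-e₀ = ar k
    where
    ar : ∀ k → (5 + k) + (5 + k) ≡ 8 + suc (suc (k * 2))
    ar = solve-∀
  C₁-order : 3 + suc (suc k) * 2 ≡ p + 3
  C₁-order = +-comm 3 p
  C₂-order : 5 + suc k * 2 ≡ p + 3
  C₂-order = ar k
    where
    ar : ∀ k → 5 + suc k * 2 ≡ suc (suc k) * 2 + 3
    ar = solve-∀

  T₁≗ : ∀ i j → adj (K 3 ⊕ Y₁) i j ≡ adjᶜ C₁ i j
  T₁≗ = compl-join-≗ (emptyG 3) (K 3) Y₁ (toWitness {a? = ≗? (adjᶜ (emptyG 3)) (adj (K 3))} tt)
  T₂≗ : ∀ i j → adj (P 5 ⊕ Y₂) i j ≡ adjᶜ C₂ i j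
  T₂≗ = compl-join-≗ (compl (P 5)) (P 5) Y₂ (compl-compl (P 5))

  module T₁ = Target (K 3) (suc (suc k)) C₁ T₁≗
  module T₂ = Target (P 5) (suc k) C₂ T₂≗

  C₁-free : ¬ (Book p ⊆ C₁)
  C₁-free = T₁.book-free p (trans C₁-order order) (toWitness {a? = twiceDominating? (adj (K 3))} tt)
                                                  (λ _ → toWitness {a? = no-isolated? (adj (K 3))} tt)
  compl-C₁ : size (compl C₁) ≡ e₀
  compl-C₁ = T₁.compl-size e₀ (ar k)
    where
    ar : ∀ k → 6 + suc (suc k) * 2 ≡ (5 + k) + (5 + k)
    ar = solve-∀
  compl-C₂ : size (compl C₂) ≡ e₀
  compl-C₂ = T₂.compl-size e₀ (ar k)
    where
    ar : ∀ k → 8 + suc k * 2 ≡ (5 + k) + (5 + k)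
    ar = solve-∀

  module Missing (G : Graph (p + 3)) (G-free : ¬ (Book p ⊆ G)) where
    dominating = book-free⇒twiceDominating p order G G-free
    sym-G = adj-sym (compl G)
    loopless-G = adj-loopless (compl G)

    fewest-missing : size (compl C₁) ≤ size (compl G)
    fewest-missing = subst (_≤ size (compl G)) (sym compl-C₁) (compl-size-≥-from-degrees G e₀
      (≤-trans (≤-reflexive double-e₀) (order+3≤degree-sum m order₅ (adjᶜ G) sym-G loopless-G dominating (3 + k) odd)))

    classify : size (compl G) ≡ size (compl C₁) → G ≅ C₁ ⊎ G ≅ C₂
    classify e = by-shape (degree-sum≡order+3⇒shape m order₅ (adjᶜ G) sym-G loopless-G dominating
                             (trans (handshake-graph (compl G)) (trans (cong₂ _+_ (trans e compl-C₁) (trans e compl-C₁)) double-e₀)))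
      where
      by-shape : (∃[ u ] degree (adjᶜ G) u ≡ 0) × m ≡ 0 ⊎ TriangleShape (adjᶜ G) ⊎ P₅Shape (adjᶜ G) → G ≅ C₁ ⊎ G ≅ C₂
      by-shape (inj₁ (_ , ()))
      by-shape (inj₂ (inj₁ T)) = inj₁ (≅-from-core G (K 3) (suc (suc k)) C₁ T₁≗
                                         (ShapeCores.triangle-core (adjᶜ G) sym-G loopless-G T (suc (suc k) * 2) C₁-order))
      by-shape (inj₂ (inj₂ S)) = inj₂ (≅-from-core G (P 5) (suc k) C₂ T₂≗
                                         (ShapeCores.path-core (adjᶜ G) sym-G loopless-G S (suc k * 2) C₂-order))

  result : ∀ (G : Graph (p + 3)) → ¬ (Book p ⊆ G) → IsEx (p + 3) (Book p) (size G) ⇔ (G ≅ C₁ ⊎ G ≅ C₂)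
  result = extremal-characterisation (Book p) C₁ C₁-order C₁-free (λ G' free → Missing.fewest-missing G' free)
             (λ G → G ≅ C₁ ⊎ G ≅ C₂) (λ G free → Missing.classify G free) size-of
    where
    size-of : ∀ G → G ≅ C₁ ⊎ G ≅ C₂ → size G ≡ size C₁
    size-of G (inj₁ G≅C₁) = size-≅ G C₁ G≅C₁
    size-of G (inj₂ G≅C₂) = trans (size-≅ G C₂ G≅C₂) (compl-size≡⇒size≡ C₂ C₁ (trans C₂-order (sym C₁-order)) (trans compl-C₂ (sym compl-C₁)))

-- p = 2: graphs of order five

module OrderFive where
  C₁ C₂ C₃ : Graph 5
  C₁ = K 1 ∨G copies 2 (P 2)
  C₂ = Kbip 2 3
  C₃ = compl (P 5)

  C₁-free : ¬ (Book 2 ⊆ C₁)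
  C₁-free = twiceDominating⇒book-free 2 refl C₁ (toWitness {a? = twiceDominating? (adjᶜ C₁)} tt)

  -- The complement K₂ ∪ K₃ of K₂,₃, with the triangle listed first.
  σ σ⁻¹ : Fin 5 → Fin 5
  σ zero = suc (suc zero)
  σ (suc zero) = suc (suc (suc zero))
  σ (suc (suc zero)) = suc (suc (suc (suc zero)))
  σ (suc (suc (suc zero))) = zero
  σ (suc (suc (suc (suc zero)))) = suc zero
  σ⁻¹ zero = suc (suc (suc zero))
  σ⁻¹ (suc zero) = suc (suc (suc (suc zero)))
  σ⁻¹ (suc (suc zero)) = zero
  σ⁻¹ (suc (suc (suc zero))) = suc zero
  σ⁻¹ (suc (suc (suc (suc zero)))) = suc (suc zero)

  triangle⊕edge≅compl-C₂ : AdjIso (adj (K 3 ⊕ copies 1 (K 2))) (adjᶜ C₂)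
  triangle⊕edge≅compl-C₂ =
    mk↔ₛ′ σ σ⁻¹ (toWitness {a? = all? (λ x → σ (σ⁻¹ x) ≟ x)} tt) (toWitness {a? = all? (λ x → σ⁻¹ (σ x) ≟ x)} tt) ,
    toWitness {a? = ≗? (adj (K 3 ⊕ copies 1 (K 2))) (λ i j → adjᶜ C₂ (σ i) (σ j))} tt

  module Missing (G : Graph 5) (G-free : ¬ (Book 2 ⊆ G)) where
    dominating = book-free⇒twiceDominating 2 refl G G-free
    sym-G = adj-sym (compl G)
    loopless-G = adj-loopless (compl G)

    fewest-missing : size (compl C₁) ≤ size (compl G)
    fewest-missing = compl-size-≥-from-degrees G 4 (order+3≤degree-sum 0 refl (adjᶜ G) sym-G loopless-G dominating 2 refl)

    classify : size (compl G) ≡ size (compl C₁) → G ≅ C₁ ⊎ G ≅ C₂ ⊎ G ≅ C₃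
    classify e = by-shape (degree-sum≡order+3⇒shape 0 refl (adjᶜ G) sym-G loopless-G dominating ∑d≡8)
      where
      ∑d≡8 : sum (degree (adjᶜ G)) ≡ 8
      ∑d≡8 = trans (handshake-graph (compl G)) (cong₂ _+_ e e)
      by-shape : (∃[ u ] degree (adjᶜ G) u ≡ 0) × 0 ≡ 0 ⊎ TriangleShape (adjᶜ G) ⊎ P₅Shape (adjᶜ G) → G ≅ C₁ ⊎ G ≅ C₂ ⊎ G ≅ C₃
      by-shape (inj₁ ((u , du) , _)) = inj₁ (≅-from-core G (compl C₁) 0 C₁
        (toWitness {a? = ≗? (adj (compl C₁ ⊕ copies 0 (K 2))) (adjᶜ C₁)} tt)
        (IsolatedVertexCase.cycle-core (adjᶜ G) sym-G loopless-G dominating u du ∑d≡8))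
      by-shape (inj₂ (inj₁ T)) = inj₂ (inj₁ (≅-from-complements G C₂ (compl C₂)
        (AdjIso-trans {c = adjᶜ C₂} (core-with-matching⇒≅ (ShapeCores.triangle-core (adjᶜ G) sym-G loopless-G T 2 refl) sym-G loopless-G
                                            (K 3) (λ _ _ → refl) 1 refl)
                      triangle⊕edge≅compl-C₂)
        (λ _ _ → refl)))
      by-shape (inj₂ (inj₂ S)) = inj₂ (inj₂ (≅-from-core G (P 5) 0 C₃
        (toWitness {a? = ≗? (adj (P 5 ⊕ copies 0 (K 2))) (adjᶜ C₃)} tt)
        (ShapeCores.path-core (adjᶜ G) sym-G loopless-G S 0 refl)))

  result : ∀ (G : Graph 5) → ¬ (Book 2 ⊆ G) → IsEx 5 (Book 2) (size G) ⇔ (G ≅ C₁ ⊎ G ≅ C₂ ⊎ G ≅ C₃)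
  result = extremal-characterisation (Book 2) C₁ refl C₁-free (λ G' free′ → Missing.fewest-missing G' free′)
             (λ G → G ≅ C₁ ⊎ G ≅ C₂ ⊎ G ≅ C₃) (λ G free′ → Missing.classify G free′) size-of
    where
    size-of : ∀ G → G ≅ C₁ ⊎ G ≅ C₂ ⊎ G ≅ C₃ → size G ≡ size C₁
    size-of G (inj₁ G≅C) = size-≅ G C₁ G≅C
    size-of G (inj₂ (inj₁ G≅C)) = size-≅ G C₂ G≅C
    size-of G (inj₂ (inj₂ G≅C)) = size-≅ G C₃ G≅C

theorem5 : (p : ℕ) → 1 ≤ p → (G : Graph (p + 3)) → ¬ (Book p ⊆ G) →
    ((p ≡ 2 → (IsEx (p + 3) (Book p) (size G) ⇔
        (G ≅ (K 1 ∨G copies 2 (P 2)) ⊎ G ≅ Kbip 2 3 ⊎ G ≅ compl (P 5))))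
    × (∀ k → p ≡ suc (suc k) * 2 → (IsEx (p + 3) (Book p) (size G) ⇔
        (G ≅ (emptyG 3 ∨G KminusPM (suc (suc k))) ⊎ G ≅ (compl (P 5) ∨G KminusPM (suc k))))))
    × (∀ k → p ≡ suc (k * 2) → (IsEx (p + 3) (Book p) (size G) ⇔ G ≅ KminusPM (suc (suc k))))
theorem5 p _ G G-free =
  ( (λ { refl → OrderFive.result G G-free })
  , (λ { k refl → EvenCase.result k G G-free }) )
  , (λ { k refl → OddCase.result k G G-free })
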